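{- Let $k\ge 3$ be an integer and $n\ge 2k+1$. Then (i) $c_2(n,S_k)\le \max\left\{\frac{4k^2-6k+2}{n-1},\ k-2-\frac{k^2-nk}{n-1}\right\}$; (ii) $c_1(n,S_k)\le \max\left\{\binom{2k-1}{2},\ \binom{n-1}{2}-\binom{n-k}{2}\right\}$.
   Context: The $k$-star $S_k$ is the $3$-graph with vertex set $\{v_0,v_1,\dots,v_{2k}\}$ and edges $\{v_0,v_{2j-1},v_{2j}\}$ for $j=1,\dots,k$. For a $3$-graph $G$ and $i\in\{1,2\}$, $\delta_i(G)$ is the minimum over $i$-subsets $S$ of vertices of the number of edges containing $S$. $G$ has an $F$-covering if every vertex lies in a copy of $F$; $c_i(n,F)$ is the maximum of $\delta_i(G)$ over $n$-vertex $3$-graphs $G$ with no $F$-covering. -}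

module Defs where

open import Data.Nat using (ℕ; zero; suc; _⊓_; _≡ᵇ_)
open import Data.Bool using (Bool; true; false; _∧_)
open import Data.List using (List; []; _∷_; map; _++_; filter; length)
open import Data.Vec using (_∷_; [])
open import Data.Fin using (Fin)
open import Data.Fin.Subset using (Subset; ∣_∣; _⊆_; _∪_; ⁅_⁆; inside; outside)
open import Data.Fin.Subset.Properties using (_⊆?_)
open import Data.Product using (Σ; _×_; _,_)
open import Data.Sum using (_⊎_)
open import Function using (Injective)
open import Relation.Binary.PropositionalEquality using (_≡_; _≢_)
open import Relation.Nullary.Decidable using (⌊_⌋)

-- A 3-graph on vertex set Fin n: a Boolean predicate on subsets of Fin n;
-- the edges are exactly the 3-element subsets S with edge S ≡ true
-- (values on subsets of other sizes are ignored).
record Graph3 (n : ℕ) : Set where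
  field
    edge : Subset n → Bool
open Graph3 public

IsEdge : ∀ {n} → Graph3 n → Subset n → Set
IsEdge G S = (∣ S ∣ ≡ 3) × (edge G S ≡ true)

isEdgeᵇ : ∀ {n} → Graph3 n → Subset n → Bool
isEdgeᵇ G S = (∣ S ∣ ≡ᵇ 3) ∧ edge G S

allSubsets : (n : ℕ) → List (Subset n)
allSubsets zero = [] ∷ []
allSubsets (suc n) = map (outside ∷_) (allSubsets n) ++ map (inside ∷_) (allSubsets n)

deg : ∀ {n} → Graph3 n → Subset n → ℕ
deg {n} G S = length (filter (λ T → S ⊆? T) (filter (λ T → isEdgeᵇ G T Data.Bool.≟ true) (allSubsets n)))
  where import Data.Bool

subsetsOfSize : (n i : ℕ) → List (Subset n)
subsetsOfSize n i = filter (λ S → ∣ S ∣ Data.Nat.≟ i) (allSubsets n)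
  where import Data.Nat

-- minimum of a list (0 for the empty list, which never occurs below)
minList : List ℕ → ℕ
minList [] = 0
minList (x ∷ []) = x
minList (x ∷ y ∷ xs) = x ⊓ minList (y ∷ xs)

δ : ∀ {n} → ℕ → Graph3 n → ℕ
δ {n} i G = minList (map (deg G) (subsetsOfSize n i))

-- v lies in a copy of the k-star S_k in G: a centre c and leaves a j, b j
-- (j = 1..k), all 2k+1 vertices distinct, with {c, a j, b j} ∈ E(G) for all j.
InStarCopy : ∀ {n} → ℕ → Graph3 n → Fin n → Set
InStarCopy {n} k G v =
  Σ (Fin n) λ c → Σ (Fin k → Fin n) λ a → Σ (Fin k → Fin n) λ b →
    Injective _≡_ _≡_ a × Injective _≡_ _≡_ b ×
    (∀ i j → a i ≢ b j) × (∀ j → c ≢ a j) × (∀ j → c ≢ b j) ×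
    (∀ j → IsEdge G (⁅ c ⁆ ∪ ⁅ a j ⁆ ∪ ⁅ b j ⁆)) ×
    ((v ≡ c) ⊎ (Σ (Fin k) λ j → (v ≡ a j) ⊎ (v ≡ b j)))

HasStarCovering : ∀ {n} → ℕ → Graph3 n → Set
HasStarCovering {n} k G = ∀ (v : Fin n) → InStarCopy k G v

-- Fix a vertex v and let L be its link: the graph on the other n - 1 vertices whose edges
-- are the pairs {x, y} with {v, x, y} an edge. A copy of S_k centred at v is the same thing
-- as a matching of size k in L.
--
-- (i) Every vertex of L has degree at least δ₂. If δ₂ ≥ k, a matching can be grown greedily
-- up to size k: given two unmatched vertices without unmatched neighbours, either some
-- matched pair is joined to both of them and can be traded for two pairs, or their degrees
-- sum to at most twice the size of the matching.
--
-- (ii) L has deg(v) ≥ δ₁ edges. By the Erdős–Gallai theorem a graph on N vertices with more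
-- than max{C(2k-1,2), C(N,2) - C(N-k+1,2)} edges has a matching of size k. It is proved by
-- shifting edges towards smaller vertices, which keeps the edge count and cannot create
-- matchings, until the graph is stable. In a stable graph the pairs {t, 2k-1-t} form a
-- matching unless one of them is missing, and a missing pair confines all edges to a
-- shape whose size is at most the bound.
--
-- So if either inequality fails, every vertex is the centre of a copy of S_k.

module Submission where

open import Defs
open import Data.Nat using (ℕ; _+_; _*_; _∸_; _≤_; _⊔_)
open import Data.Nat.Combinatorics using (_C_)
open import Data.Product using (_×_)
open import Relation.Nullary using (¬_)

open import Data.Bool using (Bool; true; false; _∧_; _∨_; not; T)
open import Data.Bool.Properties using (∨-zeroʳ) renaming (_≟_ to _≟ᵇ_)
open import Data.Empty using (⊥; ⊥-elim)
open import Data.Fin using (Fin; zero; suc; toℕ; fromℕ<; punchIn; punchOut)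
import Data.Fin.Properties as Finₚ
open import Data.Fin.Properties
  using (any?; all?; ¬∀⟶∃¬; toℕ-injective; toℕ<n; toℕ-fromℕ<; punchIn-injective; punchInᵢ≢i; punchIn-punchOut)
  renaming (_≟_ to _≟ᶠ_; _<?_ to _<ᶠ?_)
open import Data.Fin.Subset using (Subset; ∣_∣; _∪_; ⁅_⁆; inside; outside; _-_)
  renaming (_∈_ to _∈ˢ_; _∉_ to _∉ˢ_; _⊆_ to _⊆ˢ_)
open import Data.Fin.Subset.Properties
  using ( p─⊥≡p; ∣⁅x⁆∣≡1; x∈⁅x⁆; x∈⁅y⁆⇒x≡y; x∈p∪q⁺; x∈p∪q⁻; ⊆-antisym; nonempty?
        ; Empty-unique; ∣⊥∣≡0; x∈p∧x≢y⇒x∈p-y; p─q⊆p; ∪-comm)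
  renaming (_⊆?_ to _⊆ˢ?_)
open import Data.List using (List; []; _∷_; _++_; length; filter; map; concatMap; allFin; tabulate; lookup)
open import Data.List.Properties using (length-++; length-++-sucʳ; length-map; length-tabulate)
open import Data.List.Membership.Propositional using (_∈_; _∉_; find)
open import Data.List.Membership.Propositional.Properties
  using ( ∈-∃++; ∈-++⁺ˡ; ∈-++⁺ʳ; ∈-++⁻; ∈-filter⁺; ∈-filter⁻; ∈-allFin; ∈-concat⁺′; ∈-map⁺; ∈-map⁻
        ; ∈-tabulate⁻; ∈-lookup)
open import Data.List.Relation.Binary.Permutation.Propositional
  using (_↭_; ↭-refl; ↭-prep; ↭-swap; ↭-trans; ↭-sym; ↭⇒↭ₛ)
open import Data.List.Relation.Binary.Permutation.Propositional.Properties
  using (∈-resp-↭) renaming (shift to ↭-shift)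
open import Data.List.Relation.Binary.Subset.Propositional using (_⊆_)
open import Data.List.Relation.Unary.All as All using (All; []; _∷_)
open import Data.List.Relation.Unary.All.Properties using (¬Any⇒All¬; All¬⇒¬Any)
open import Data.List.Relation.Unary.AllPairs as AllPairs using ([]; _∷_)
open import Data.List.Relation.Unary.Any using (here; there) renaming (any? to anyₗ?)
open import Data.List.Relation.Unary.Unique.Propositional using (Unique)
open import Data.List.Relation.Unary.Unique.Propositional.Properties using (allFin⁺; filter⁺; map⁺; ++⁺)
open import Data.Nat using (zero; suc; _<_; _≤?_; _<?_; _≡ᵇ_; z≤n; s≤s; z<s; s<s; s≤s⁻¹; >-nonZero)
open import Data.Nat.Combinatorics using (nC1≡n; nCk+nC[k+1]≡[n+1]C[k+1])
open import Data.Nat.Induction using (<-wellFounded)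
open import Data.Nat.Properties
open import Data.Nat.Solver using (module +-*-Solver)
open import Algebra.Properties.CommutativeMonoid.Sum +-0-commutativeMonoid
  using (sum; sum-syntax; sum-cong-≗; ∑-distrib-+)
open import Algebra.Properties.CommutativeSemigroup +-commutativeSemigroup using (x∙yz≈y∙xz)
open import Data.Product using (Σ-syntax; ∃-syntax; _,_; proj₁; proj₂; swap; uncurry)
open import Data.Sum using (_⊎_; inj₁; inj₂; [_,_]′)
open import Data.Vec using ([]; _∷_) renaming (here to hereˢ; there to thereˢ)
open import Data.Vec.Functional using (updateAt)
open import Data.Vec.Functional.Properties using (updateAt-updates; updateAt-minimal)
open import Data.Vec.Properties using (∷-injectiveʳ)
open import Function using (id; _∘_; _$_; const)
open import Function.Definitions using (Injective)
open import Induction.WellFounded using (Acc; acc)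
open import Relation.Binary.Definitions using (tri<; tri≈; tri>)
open import Relation.Binary.PropositionalEquality
  using (_≡_; _≢_; refl; sym; trans; cong; cong₂; subst; subst₂; setoid; module ≡-Reasoning)
open import Relation.Nullary using (Dec; yes; no; does; ¬?)
open import Relation.Nullary.Decidable using (decidable-stable; dec-true; dec-false; _×-dec_; _⊎-dec_)

open +-*-Solver using (solve; _:+_; _:*_; _:=_; con)

⟦_⟧ : Bool → ℕ
⟦ true ⟧ = 1
⟦ false ⟧ = 0

⟦⟧-¬× : ∀ {P Q : Set} (P? : Dec P) (Q? : Dec Q) → ¬ (P × Q) → ⟦ does P? ⟧ + ⟦ does Q? ⟧ ≤ 1
⟦⟧-¬× (yes p) (yes q) ¬pq = ⊥-elim (¬pq (p , q))
⟦⟧-¬× (yes _) (no _) _ = ≤-refl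
⟦⟧-¬× (no _) (yes _) _ = ≤-refl
⟦⟧-¬× (no _) (no _) _ = z≤n

erase : ∀ {n} → Fin n → (Fin n → ℕ) → Fin n → ℕ
erase i f = updateAt f i (const 0)

sum-erase : ∀ {n} i (f : Fin n → ℕ) → sum f ≡ f i + sum (erase i f)
sum-erase zero f = refl
sum-erase (suc i) f = begin
  f zero + sum (f ∘ suc)                           ≡⟨ cong (f zero +_) (sum-erase i (f ∘ suc)) ⟩
  f zero + (f (suc i) + sum (erase i (f ∘ suc)))   ≡⟨ x∙yz≈y∙xz (f zero) (f (suc i)) _ ⟩
  f (suc i) + (f zero + sum (erase i (f ∘ suc)))   ∎
  where open ≡-Reasoning

sum-erase₂ : ∀ {n} {i j : Fin n} (f : Fin n → ℕ) → i ≢ j →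
  sum f ≡ (f i + f j) + sum (erase j (erase i f))
sum-erase₂ {i = i} {j} f i≢j = begin
  sum f                                          ≡⟨ sum-erase i f ⟩
  f i + sum (erase i f)                          ≡⟨ cong (f i +_) (sum-erase j (erase i f)) ⟩
  f i + (erase i f j + sum (erase j (erase i f))) ≡⟨ cong (λ t → f i + (t + sum (erase j (erase i f)))) (updateAt-minimal j i f (i≢j ∘ sym)) ⟩
  f i + (f j + sum (erase j (erase i f)))        ≡⟨ sym (+-assoc (f i) (f j) _) ⟩
  (f i + f j) + sum (erase j (erase i f))        ∎
  where open ≡-Reasoning

erase₂-cong : ∀ {n} {i j : Fin n} {f g : Fin n → ℕ} → (∀ a → a ≢ i → a ≢ j → f a ≡ g a) →
  ∀ a → erase j (erase i f) a ≡ erase j (erase i g) a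
erase₂-cong {i = i} {j} {f} {g} f≡g a with a ≟ᶠ j | a ≟ᶠ i
... | yes refl | _ = trans (updateAt-updates a (erase i f)) (sym (updateAt-updates a (erase i g)))
... | no a≢j | yes refl = begin
  erase j (erase a f) a ≡⟨ updateAt-minimal a j (erase a f) a≢j ⟩
  erase a f a           ≡⟨ updateAt-updates a f ⟩
  0                     ≡⟨ sym (updateAt-updates a g) ⟩
  erase a g a           ≡⟨ sym (updateAt-minimal a j (erase a g) a≢j) ⟩
  erase j (erase a g) a ∎
  where open ≡-Reasoning
... | no a≢j | no a≢i = begin
  erase j (erase i f) a ≡⟨ updateAt-minimal a j (erase i f) a≢j ⟩
  erase i f a           ≡⟨ updateAt-minimal a i f a≢i ⟩
  f a                   ≡⟨ f≡g a a≢i a≢j ⟩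
  g a                   ≡⟨ sym (updateAt-minimal a i g a≢i) ⟩
  erase i g a           ≡⟨ sym (updateAt-minimal a j (erase i g) a≢j) ⟩
  erase j (erase i g) a ∎
  where open ≡-Reasoning

module _ {n} {i j : Fin n} {f g : Fin n → ℕ} (i≢j : i ≢ j) (f≡g : ∀ a → a ≢ i → a ≢ j → f a ≡ g a) where

  private
    rest≡ : sum (erase j (erase i f)) ≡ sum (erase j (erase i g))
    rest≡ = sum-cong-≗ (erase₂-cong f≡g)

  sum-cong-off₂ : f i + f j ≡ g i + g j → sum f ≡ sum g
  sum-cong-off₂ eq = trans (sum-erase₂ f i≢j) (trans (cong₂ _+_ eq rest≡) (sym (sum-erase₂ g i≢j)))

  sum-<-off₂ : f i + f j < g i + g j → sum f < sum g
  sum-<-off₂ lt = subst₂ _<_ (sym (sum-erase₂ f i≢j)) (sym (sum-erase₂ g i≢j))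
    (+-mono-<-≤ lt (≤-reflexive rest≡))

sum-mono-≤ : ∀ {n} {f g : Fin n → ℕ} → (∀ a → f a ≤ g a) → sum f ≤ sum g
sum-mono-≤ {zero} _ = z≤n
sum-mono-≤ {suc n} f≤g = +-mono-≤ (f≤g zero) (sum-mono-≤ (f≤g ∘ suc))

sum-mono-< : ∀ {n} {f g : Fin n → ℕ} → (∀ a → f a ≤ g a) → ∀ b → f b < g b → sum f < sum g
sum-mono-< {f = f} {g} f≤g b fb<gb =
  subst₂ _<_ (sym (sum-erase b f)) (sym (sum-erase b g)) (+-mono-<-≤ fb<gb (sum-mono-≤ erased≤))
  where
  erased≤ : ∀ a → erase b f a ≤ erase b g a
  erased≤ a with a ≟ᶠ b
  ... | yes refl = ≤-reflexive (trans (updateAt-updates a f) (sym (updateAt-updates a g)))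
  ... | no a≢b = subst₂ _≤_ (sym (updateAt-minimal a b f a≢b)) (sym (updateAt-minimal a b g a≢b)) (f≤g a)

sum-toℕ-+ : ∀ m n (g : ℕ → ℕ) →
  ∑[ t < m + n ] g (toℕ t) ≡ ∑[ t < m ] g (toℕ t) + ∑[ t < n ] g (m + toℕ t)
sum-toℕ-+ zero n g = refl
sum-toℕ-+ (suc m) n g = trans (cong (g 0 +_) (sum-toℕ-+ m n (g ∘ suc))) (sym (+-assoc (g 0) _ _))

sum-toℕ-const : ∀ n c (g : ℕ → ℕ) → (∀ t → t < n → g t ≡ c) → ∑[ t < n ] g (toℕ t) ≡ n * c
sum-toℕ-const zero c g _ = refl
sum-toℕ-const (suc n) c g g≡c =
  cong₂ _+_ (g≡c 0 z<s) (sum-toℕ-const n c (g ∘ suc) (λ t t<n → g≡c (suc t) (s<s t<n)))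

length-filter-tabulate : ∀ {A : Set} {P : A → Set} (P? : ∀ x → Dec (P x)) {n} (h : Fin n → A) →
  length (filter P? (tabulate h)) ≡ ∑[ a < n ] ⟦ does (P? (h a)) ⟧
length-filter-tabulate P? {zero} h = refl
length-filter-tabulate P? {suc n} h with does (P? (h zero))
... | true = cong suc (length-filter-tabulate P? (h ∘ suc))
... | false = length-filter-tabulate P? (h ∘ suc)

length-concatMap-tabulate : ∀ {A B : Set} (f : A → List B) {n} (h : Fin n → A) →
  length (concatMap f (tabulate h)) ≡ ∑[ a < n ] length (f (h a))
length-concatMap-tabulate f {zero} h = refl
length-concatMap-tabulate f {suc n} h =
  trans (length-++ (f (h zero))) (cong (length (f (h zero)) +_) (length-concatMap-tabulate f (h ∘ suc)))

module _ {A : Set} where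

  open import Data.List.Relation.Binary.Permutation.Setoid.Properties (setoid A)
    using (Unique-resp-↭)

  unique-resp-↭ : ∀ {xs ys : List A} → xs ↭ ys → Unique xs → Unique ys
  unique-resp-↭ p = Unique-resp-↭ (↭⇒↭ₛ p)

  fresh-∷ : ∀ {x : A} {xs} → x ∉ xs → Unique xs → Unique (x ∷ xs)
  fresh-∷ {xs = xs} x∉xs u = ¬Any⇒All¬ xs x∉xs ∷ u

  Unique-∷⇒∉ : ∀ {x : A} {xs} → Unique (x ∷ xs) → x ∉ xs
  Unique-∷⇒∉ = All¬⇒¬Any ∘ AllPairs.head

  Unique⇒length≤ : ∀ {xs ys : List A} → Unique xs → xs ⊆ ys → length xs ≤ length ys
  Unique⇒length≤ {[]} _ _ = z≤n
  Unique⇒length≤ {x ∷ xs} {ys} (x∉xs ∷ u) xs⊆ys with ∈-∃++ (xs⊆ys (here refl))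
  ... | ys₁ , ys₂ , refl = begin
    suc (length xs)               ≤⟨ s≤s (Unique⇒length≤ u xs⊆ys₁ys₂) ⟩
    suc (length (ys₁ ++ ys₂))     ≡⟨ sym (length-++-sucʳ ys₁ x ys₂) ⟩
    length (ys₁ ++ x ∷ ys₂)       ∎
    where
    open ≤-Reasoning
    xs⊆ys₁ys₂ : xs ⊆ ys₁ ++ ys₂
    xs⊆ys₁ys₂ z∈xs with ∈-++⁻ ys₁ (xs⊆ys (there z∈xs))
    ... | inj₁ z∈ys₁ = ∈-++⁺ˡ z∈ys₁
    ... | inj₂ (here refl) = ⊥-elim (All¬⇒¬Any x∉xs z∈xs)
    ... | inj₂ (there z∈ys₂) = ∈-++⁺ʳ ys₁ z∈ys₂

  endpoints : List (A × A) → List A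
  endpoints [] = []
  endpoints ((a , b) ∷ M) = a ∷ b ∷ endpoints M

  endpoints-++ : ∀ M₁ M₂ → endpoints (M₁ ++ M₂) ≡ endpoints M₁ ++ endpoints M₂
  endpoints-++ [] M₂ = refl
  endpoints-++ ((a , b) ∷ M₁) M₂ = cong (λ l → a ∷ b ∷ l) (endpoints-++ M₁ M₂)

  endpoints-↭ : ∀ M₁ a b M₂ → endpoints (M₁ ++ (a , b) ∷ M₂) ↭ a ∷ b ∷ endpoints (M₁ ++ M₂)
  endpoints-↭ M₁ a b M₂
    rewrite endpoints-++ M₁ ((a , b) ∷ M₂) | endpoints-++ M₁ M₂ =
    ↭-trans (↭-shift a (endpoints M₁) _) (↭-prep a (↭-shift b (endpoints M₁) _))

  ∈-endpoints⁻ : ∀ {z} M → z ∈ endpoints M → ∃[ p ] p ∈ M × (z ≡ proj₁ p ⊎ z ≡ proj₂ p)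
  ∈-endpoints⁻ (p ∷ M) (here z≡a) = p , here refl , inj₁ z≡a
  ∈-endpoints⁻ (p ∷ M) (there (here z≡b)) = p , here refl , inj₂ z≡b
  ∈-endpoints⁻ (p ∷ M) (there (there z∈M)) with ∈-endpoints⁻ M z∈M
  ... | q , q∈M , z∈q = q , there q∈M , z∈q

  length-endpoints : ∀ M → length (endpoints M) ≡ length M + length M
  length-endpoints [] = refl
  length-endpoints ((a , b) ∷ M) = cong suc (trans (cong suc (length-endpoints M)) (sym (+-suc (length M) (length M))))

module _ {A : Set} {P : A → Set} where

  All-remove : ∀ xs {x ys} → All P (xs ++ x ∷ ys) → P x × All P (xs ++ ys)
  All-remove [] (px ∷ pys) = px , pys
  All-remove (z ∷ xs) (pz ∷ pxs) with All-remove xs pxs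
  ... | px , prest = px , pz ∷ prest

  length-filter-∷ : ∀ (P? : ∀ x → Dec (P x)) x xs →
    length (filter P? (x ∷ xs)) ≡ ⟦ does (P? x) ⟧ + length (filter P? xs)
  length-filter-∷ P? x xs with does (P? x)
  ... | true = refl
  ... | false = refl

-- Graphs and matchings

Graph : ℕ → Set
Graph N = Fin N → Fin N → Bool

Symmetric : ∀ {N} → Graph N → Set
Symmetric G = ∀ a b → G a b ≡ G b a

Irreflexive : ∀ {N} → Graph N → Set
Irreflexive G = ∀ a → G a a ≡ false

module _ {N : ℕ} (G : Graph N) where

  Adj : Fin N → Fin N → Set
  Adj a b = G a b ≡ true

  adj? : ∀ a b → Dec (Adj a b)
  adj? a b = G a b ≟ᵇ true

  degree : Fin N → ℕ
  degree a = ∑[ b < N ] ⟦ G a b ⟧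

  degree-sum : ℕ
  degree-sum = ∑[ a < N ] degree a

  record IsMatching (M : List (Fin N × Fin N)) : Set where
    constructor isMatching
    field
      disjoint : Unique (endpoints M)
      edges : All (uncurry Adj) M

  open IsMatching public

  Matching : ℕ → Set
  Matching k = Σ[ M ∈ List (Fin N × Fin N) ] length M ≡ k × IsMatching M

module _ {N : ℕ} {G : Graph N} where

  record Partnered (M : List (Fin N × Fin N)) (v : Fin N) : Set where
    field
      partner : Fin N
      others : List (Fin N × Fin N)
      size : length M ≡ suc (length others)
      adjacent : Adj G v partner
      others-matching : IsMatching G others
      reorder : endpoints M ↭ v ∷ partner ∷ endpoints others

  partnered : Symmetric G → ∀ {M v} → IsMatching G M → v ∈ endpoints M → Partnered M v
  partnered G-sym {M} {v} (isMatching disjoint edges) v∈M with ∈-endpoints⁻ M v∈M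
  ... | (a , b) , ab∈M , v≡a∨b with ∈-∃++ ab∈M
  ... | M₁ , M₂ , refl = oriented v≡a∨b
    where
    R = endpoints (M₁ ++ M₂)
    moved = endpoints-↭ M₁ a b M₂
    split = All-remove M₁ edges
    others-matching = isMatching (AllPairs.tail (AllPairs.tail (unique-resp-↭ moved disjoint))) (proj₂ split)
    oriented : v ≡ a ⊎ v ≡ b → Partnered (M₁ ++ (a , b) ∷ M₂) v
    oriented (inj₁ refl) = record
      { partner = b ; others = M₁ ++ M₂ ; size = length-++-sucʳ M₁ (a , b) M₂
      ; adjacent = proj₁ split ; others-matching = others-matching ; reorder = moved }
    oriented (inj₂ refl) = record
      { partner = a ; others = M₁ ++ M₂ ; size = length-++-sucʳ M₁ (a , b) M₂
      ; adjacent = trans (G-sym b a) (proj₁ split) ; others-matching = others-matching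
      ; reorder = ↭-trans moved (↭-swap a b ↭-refl) }

record Family {N : ℕ} (G : Graph N) (k : ℕ) : Set where
  field
    left right : Fin k → Fin N
    left-injective : Injective _≡_ _≡_ left
    right-injective : Injective _≡_ _≡_ right
    left≢right : ∀ x y → left x ≢ right y
    adjacent : ∀ x → Adj G (left x) (right x)

module _ {N : ℕ} {G : Graph N} where

  endpoints-tabulate⁻ : ∀ {k} (a b : Fin k → Fin N) {z} → z ∈ endpoints (tabulate (λ x → a x , b x)) →
    ∃[ x ] (z ≡ a x ⊎ z ≡ b x)
  endpoints-tabulate⁻ a b z∈ with ∈-endpoints⁻ _ z∈
  ... | p , p∈ , z∈p with ∈-tabulate⁻ p∈
  ... | x , refl = x , z∈p

  unique-endpoints-tabulate : ∀ {k} (a b : Fin k → Fin N) → Injective _≡_ _≡_ a → Injective _≡_ _≡_ b →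
    (∀ x y → a x ≢ b y) → Unique (endpoints (tabulate (λ x → a x , b x)))
  unique-endpoints-tabulate {zero} a b _ _ _ = []
  unique-endpoints-tabulate {suc k} a b a-inj b-inj a≢b =
    fresh-∷ a₀∉ (fresh-∷ b₀∉ (unique-endpoints-tabulate (a ∘ suc) (b ∘ suc)
      (Finₚ.suc-injective ∘ a-inj) (Finₚ.suc-injective ∘ b-inj) (λ x y → a≢b (suc x) (suc y))))
    where
    R = endpoints (tabulate (λ x → a (suc x) , b (suc x)))
    b₀∉ : b zero ∉ R
    b₀∉ b₀∈ with endpoints-tabulate⁻ (a ∘ suc) (b ∘ suc) b₀∈
    ... | x , inj₁ b₀≡ax = a≢b (suc x) zero (sym b₀≡ax)
    ... | x , inj₂ b₀≡bx with b-inj b₀≡bx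
    ...   | ()
    a₀∉ : a zero ∉ b zero ∷ R
    a₀∉ (here a₀≡b₀) = a≢b zero zero a₀≡b₀
    a₀∉ (there a₀∈) with endpoints-tabulate⁻ (a ∘ suc) (b ∘ suc) a₀∈
    ... | x , inj₂ a₀≡bx = a≢b zero (suc x) a₀≡bx
    ... | x , inj₁ a₀≡ax with a-inj a₀≡ax
    ...   | ()

  matching-of-family : ∀ {k} → Family G k → Matching G k
  matching-of-family F = tabulate (λ x → left x , right x) , length-tabulate _ ,
    isMatching (unique-endpoints-tabulate left right left-injective right-injective left≢right)
               (All.tabulate λ p∈ → let x , p≡ = ∈-tabulate⁻ p∈ in subst-edge p≡ (adjacent x))
    where
    open Family F
    subst-edge : ∀ {p x} → p ≡ (left x , right x) → Adj G (left x) (right x) → Adj G (proj₁ p) (proj₂ p)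
    subst-edge refl e = e

  end : Bool → Fin N × Fin N → Fin N
  end true = proj₁
  end false = proj₂

  end-∈ : ∀ M s x → end s (lookup M x) ∈ endpoints M
  end-∈ ((a , b) ∷ M) true zero = here refl
  end-∈ ((a , b) ∷ M) false zero = there (here refl)
  end-∈ ((a , b) ∷ M) s (suc x) = there (there (end-∈ M s x))

  end∉ : ∀ {a b R} → Unique (a ∷ b ∷ R) → ∀ s → end s (a , b) ∉ R
  end∉ abR true = Unique-∷⇒∉ abR ∘ there
  end∉ abR false = Unique-∷⇒∉ (AllPairs.tail abR)

  lookup-end-injective : ∀ M → Unique (endpoints M) → ∀ {x y s t} →
    end s (lookup M x) ≡ end t (lookup M y) → x ≡ y × s ≡ t
  lookup-end-injective (_ ∷ M) U {zero} {zero} {true} {true} _ = refl , refl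
  lookup-end-injective (_ ∷ M) U {zero} {zero} {false} {false} _ = refl , refl
  lookup-end-injective (_ ∷ M) U {zero} {zero} {true} {false} a≡b = ⊥-elim (Unique-∷⇒∉ U (here a≡b))
  lookup-end-injective (_ ∷ M) U {zero} {zero} {false} {true} b≡a = ⊥-elim (Unique-∷⇒∉ U (here (sym b≡a)))
  lookup-end-injective (_ ∷ M) U {zero} {suc y} {s} {t} e = ⊥-elim (end∉ U s (subst (_∈ endpoints M) (sym e) (end-∈ M t y)))
  lookup-end-injective (_ ∷ M) U {suc x} {zero} {s} {t} e = ⊥-elim (end∉ U t (subst (_∈ endpoints M) e (end-∈ M s x)))
  lookup-end-injective (_ ∷ M) U {suc x} {suc y} e =
    let x≡y , s≡t = lookup-end-injective M (AllPairs.tail (AllPairs.tail U)) e in cong suc x≡y , s≡t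

  family-of-matching : ∀ {k} → Matching G k → Family G k
  family-of-matching (M , refl , isMatching U edges) = record
    { left = proj₁ ∘ lookup M
    ; right = proj₂ ∘ lookup M
    ; left-injective = proj₁ ∘ lookup-end-injective M U {s = true} {t = true}
    ; right-injective = proj₁ ∘ lookup-end-injective M U {s = false} {t = false}
    ; left≢right = λ x y → (λ ()) ∘ proj₂ ∘ lookup-end-injective M U {x} {y} {true} {false}
    ; adjacent = λ x → All.lookup edges (∈-lookup x)
    }

module _ {N : ℕ} (G : Graph N) where

  degree-in : Fin N → List (Fin N) → ℕ
  degree-in x zs = length (filter (adj? G x) zs)

  degree≡degree-in : ∀ x → degree G x ≡ degree-in x (allFin N)
  degree≡degree-in x = sym (trans (length-filter-tabulate (adj? G x) id) (sum-cong-≗ (cong ⟦_⟧ ∘ does-≟true ∘ G x)))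
    where
    does-≟true : ∀ b → does (b ≟ᵇ true) ≡ b
    does-≟true false = refl
    does-≟true true = refl

  degree≤degree-in : ∀ x F → (∀ {z} → Adj G x z → z ∈ F) → degree G x ≤ degree-in x F
  degree≤degree-in x F nbrs⊆F = subst (_≤ degree-in x F) (sym (degree≡degree-in x)) $ Unique⇒length≤ (filter⁺ (adj? G x) (allFin⁺ N)) λ z∈ →
    let xz = proj₂ (∈-filter⁻ (adj? G x) {xs = allFin N} z∈) in ∈-filter⁺ (adj? G x) (nbrs⊆F xz) xz

  arcs : List (Fin N × Fin N)
  arcs = concatMap (λ a → map (a ,_) (filter (adj? G a) (allFin N))) (allFin N)

  ∈-arcs⁺ : ∀ {a b} → Adj G a b → (a , b) ∈ arcs
  ∈-arcs⁺ {a} {b} ab = ∈-concat⁺′ (∈-map⁺ (a ,_) (∈-filter⁺ (adj? G a) (∈-allFin b) ab)) (∈-map⁺ _ (∈-allFin a))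

  length-arcs : length arcs ≡ degree-sum G
  length-arcs = trans (length-concatMap-tabulate (λ a → map (a ,_) (filter (adj? G a) (allFin N))) id)
    (sum-cong-≗ λ a → trans (length-map (a ,_) (filter (adj? G a) (allFin N))) (sym (degree≡degree-in a)))

-- Matchings in graphs of large minimum degree

module _ {N : ℕ} where

  open import Data.List.Membership.DecPropositional (_≟ᶠ_ {N}) using (_∈?_)

  fresh : (L : List (Fin N)) → length L < N → ∃[ x ] x ∉ L
  fresh L |L|<N with any? (λ x → ¬? (x ∈? L))
  ... | yes found = found
  ... | no none = ⊥-elim (<⇒≱ |L|<N (subst (_≤ length L) (length-tabulate id) (Unique⇒length≤ (allFin⁺ N) all∈L)))
    where
    all∈L : allFin N ⊆ L
    all∈L {x} _ = decidable-stable (x ∈? L) (λ x∉L → none (x , x∉L))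

module _ {N : ℕ} (G : Graph N) (irreflexive : Irreflexive G) where

  open import Data.List.Membership.DecPropositional (_≟ᶠ_ {N}) using (_∈?_)

  adj⇒≢ : ∀ {a b} → Adj G a b → a ≢ b
  adj⇒≢ {a} ab refl with trans (sym (irreflexive a)) ab
  ... | ()

  Crossing : Fin N → Fin N → Fin N × Fin N → Set
  Crossing x y (a , b) = (Adj G x a × Adj G y b) ⊎ (Adj G x b × Adj G y a)

  crossing? : ∀ x y p → Dec (Crossing x y p)
  crossing? x y (a , b) = (adj? G x a ×-dec adj? G y b) ⊎-dec (adj? G x b ×-dec adj? G y a)

  degree-in-endpoints : ∀ x y M → All (¬_ ∘ Crossing x y) M →
    degree-in G x (endpoints M) + degree-in G y (endpoints M) ≤ length M + length M
  degree-in-endpoints x y [] [] = z≤n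
  degree-in-endpoints x y ((a , b) ∷ M) (¬cross ∷ ¬crossM) = begin
    degree-in G x (a ∷ b ∷ E) + degree-in G y (a ∷ b ∷ E)
      ≡⟨ cong₂ _+_ (trans (length-filter-∷ (adj? G x) a (b ∷ E)) (cong (⟦ xa ⟧ +_) (length-filter-∷ (adj? G x) b E)))
                   (trans (length-filter-∷ (adj? G y) a (b ∷ E)) (cong (⟦ ya ⟧ +_) (length-filter-∷ (adj? G y) b E))) ⟩
    (⟦ xa ⟧ + (⟦ xb ⟧ + degree-in G x E)) + (⟦ ya ⟧ + (⟦ yb ⟧ + degree-in G y E))
      ≡⟨ solve 6 (λ p q r s u v → (p :+ (q :+ u)) :+ (r :+ (s :+ v)) := (p :+ s) :+ (q :+ r) :+ (u :+ v)) refl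
               ⟦ xa ⟧ ⟦ xb ⟧ ⟦ ya ⟧ ⟦ yb ⟧ (degree-in G x E) (degree-in G y E) ⟩
    (⟦ xa ⟧ + ⟦ yb ⟧) + (⟦ xb ⟧ + ⟦ ya ⟧) + (degree-in G x E + degree-in G y E)
      ≤⟨ +-mono-≤ (+-mono-≤ (⟦⟧-¬× (adj? G x a) (adj? G y b) (¬cross ∘ inj₁))
                             (⟦⟧-¬× (adj? G x b) (adj? G y a) (¬cross ∘ inj₂)))
                  (degree-in-endpoints x y M ¬crossM) ⟩
    2 + (length M + length M)
      ≡⟨ cong suc (sym (+-suc (length M) (length M))) ⟩
    suc (length M) + suc (length M) ∎
    where
    open ≤-Reasoning
    E = endpoints M
    xa = does (adj? G x a)
    xb = does (adj? G x b)
    ya = does (adj? G y a)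
    yb = does (adj? G y b)

  add-pair : ∀ {M u z} → IsMatching G M → u ∉ endpoints M → z ∉ endpoints M → Adj G u z →
    IsMatching G ((u , z) ∷ M)
  add-pair {M} {u} {z} (isMatching disjoint edges) u∉M z∉M uz =
    isMatching (fresh-∷ u∉zM (fresh-∷ z∉M disjoint)) (uz ∷ edges)
    where
    u∉zM : u ∉ z ∷ endpoints M
    u∉zM (here u≡z) = adj⇒≢ uz u≡z
    u∉zM (there u∈M) = u∉M u∈M

  swap-in : ∀ M₁ {a b} M₂ {x y} → let M = M₁ ++ (a , b) ∷ M₂ in
    IsMatching G M → x ∉ endpoints M → y ∉ endpoints M → x ≢ y → Adj G x a → Adj G y b →
    IsMatching G ((x , a) ∷ (y , b) ∷ (M₁ ++ M₂))
  swap-in M₁ {a} {b} M₂ {x} {y} (isMatching disjoint edges) x∉M y∉M x≢y xa yb =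
    isMatching (unique-resp-↭ (↭-prep x (↭-swap y a ↭-refl)) (fresh-∷ x∉ (fresh-∷ y∉ ab-disjoint)))
               (xa ∷ yb ∷ proj₂ (All-remove M₁ edges))
    where
    R = endpoints (M₁ ++ M₂)
    moved = endpoints-↭ M₁ a b M₂
    ab-disjoint : Unique (a ∷ b ∷ R)
    ab-disjoint = unique-resp-↭ moved disjoint
    y∉ : y ∉ a ∷ b ∷ R
    y∉ = y∉M ∘ ∈-resp-↭ (↭-sym moved)
    x∉ : x ∉ y ∷ a ∷ b ∷ R
    x∉ (here x≡y) = x≢y x≡y
    x∉ (there x∈) = x∉M (∈-resp-↭ (↭-sym moved) x∈)

  neighbour-outside? : ∀ x F → (∃[ z ] z ∉ F × Adj G x z) ⊎ (∀ {z} → Adj G x z → z ∈ F)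
  neighbour-outside? x F with any? (λ z → ¬? (z ∈? F) ×-dec adj? G x z)
  ... | yes found = inj₁ found
  ... | no none = inj₂ λ {z} xz → decidable-stable (z ∈? F) (λ z∉F → none (z , z∉F , xz))

  -- Greedy augmentation: two unmatched vertices x, y either have an unmatched neighbour,
  -- or some pair crosses them, or their degrees sum to at most 2 |M| < 2 d.
  module _ {d} (2d≤N : d + d ≤ N) (mindeg : ∀ a → d ≤ degree G a)
           {M} (isM : IsMatching G M) (M<d : length M < d) where

    private
      E = endpoints M

      |E|<N : length E < N
      |E|<N = begin-strict
        length E          ≡⟨ length-endpoints M ⟩
        length M + length M <⟨ +-mono-< M<d M<d ⟩
        d + d             ≤⟨ 2d≤N ⟩
        N                 ∎
        where open ≤-Reasoning

      |xE|<N : ∀ x → length (x ∷ E) < N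
      |xE|<N x = begin-strict
        suc (length E)              ≡⟨ cong suc (length-endpoints M) ⟩
        suc (length M + length M)   <⟨ s≤s (+-monoʳ-< (length M) M<d) ⟩
        suc (length M + d)          ≤⟨ +-monoˡ-≤ d M<d ⟩
        d + d                       ≤⟨ 2d≤N ⟩
        N                           ∎
        where open ≤-Reasoning

      x = proj₁ (fresh E |E|<N)
      x∉E = proj₂ (fresh E |E|<N)
      y = proj₁ (fresh (x ∷ E) (|xE|<N x))
      y∉xE = proj₂ (fresh (x ∷ E) (|xE|<N x))

      y∉E : y ∉ E
      y∉E = y∉xE ∘ there

      x≢y : x ≢ y
      x≢y x≡y = y∉xE (here (sym x≡y))

      crossing-pair : ∃[ p ] p ∈ M × Crossing x y p → Matching G (suc (length M))
      crossing-pair ((a , b) , ab∈M , crossing) with ∈-∃++ ab∈M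
      ... | M₁ , M₂ , refl = traded crossing
        where
        size : suc (suc (length (M₁ ++ M₂))) ≡ suc (length (M₁ ++ (a , b) ∷ M₂))
        size = cong suc (sym (length-++-sucʳ M₁ (a , b) M₂))
        traded : Crossing x y (a , b) → Matching G (suc (length (M₁ ++ (a , b) ∷ M₂)))
        traded (inj₁ (xa , yb)) = (x , a) ∷ (y , b) ∷ (M₁ ++ M₂) , size , swap-in M₁ M₂ isM x∉E y∉E x≢y xa yb
        traded (inj₂ (xb , ya)) = (y , a) ∷ (x , b) ∷ (M₁ ++ M₂) , size , swap-in M₁ M₂ isM y∉E x∉E (x≢y ∘ sym) ya xb

    augment : Matching G (suc (length M))
    augment with neighbour-outside? x E | neighbour-outside? y E
    ... | inj₁ (z , z∉E , xz) | _ = (x , z) ∷ M , refl , add-pair isM x∉E z∉E xz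
    ... | inj₂ _ | inj₁ (z , z∉E , yz) = (y , z) ∷ M , refl , add-pair isM y∉E z∉E yz
    ... | inj₂ x-inside | inj₂ y-inside with anyₗ? (crossing? x y) M
    ... | yes crossing = crossing-pair (find crossing)
    ... | no ¬crossing = ⊥-elim (<⇒≱ (+-mono-< M<d M<d) (begin
      d + d                     ≤⟨ +-mono-≤ (mindeg x) (mindeg y) ⟩
      degree G x + degree G y   ≤⟨ +-mono-≤ (degree≤degree-in G x E x-inside) (degree≤degree-in G y E y-inside) ⟩
      degree-in G x E + degree-in G y E     ≤⟨ degree-in-endpoints x y M (¬Any⇒All¬ M ¬crossing) ⟩
      length M + length M       ∎))
      where open ≤-Reasoning

  matching-of-minDegree : ∀ d → d + d ≤ N → (∀ a → d ≤ degree G a) → Matching G d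
  matching-of-minDegree d 2d≤N mindeg = grow d ≤-refl
    where
    grow : ∀ m → m ≤ d → Matching G m
    grow zero _ = [] , refl , isMatching [] []
    grow (suc m) m<d with grow m (<⇒≤ m<d)
    ... | M , refl , isM = augment 2d≤N mindeg isM m<d

-- Shifting

⟦∨⟧+⟦∧⟧ : ∀ x y → ⟦ x ∨ y ⟧ + ⟦ y ∧ x ⟧ ≡ ⟦ x ⟧ + ⟦ y ⟧
⟦∨⟧+⟦∧⟧ false false = refl
⟦∨⟧+⟦∧⟧ false true = refl
⟦∨⟧+⟦∧⟧ true false = refl
⟦∨⟧+⟦∧⟧ true true = refl

⟦∧⟧≤⟦⟧ : ∀ x y → ⟦ x ∧ y ⟧ ≤ ⟦ x ⟧
⟦∧⟧≤⟦⟧ false y = z≤n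
⟦∧⟧≤⟦⟧ true false = z≤n
⟦∧⟧≤⟦⟧ true true = ≤-refl

∧-true⁻ : ∀ {x y} → x ∧ y ≡ true → x ≡ true × y ≡ true
∧-true⁻ {true} {true} refl = refl , refl

∨-true⁻ : ∀ {x y} → x ∨ y ≡ true → x ≢ true → y ≡ true
∨-true⁻ {true} _ x≢true = ⊥-elim (x≢true refl)
∨-true⁻ {false} y≡true _ = y≡true

∨-changed : ∀ x y → x ∨ y ≢ x → x ≡ false × y ≡ true
∨-changed false false changed = ⊥-elim (changed refl)
∨-changed false true _ = refl , refl
∨-changed true y changed = ⊥-elim (changed refl)

∧-changed : ∀ x y → x ∧ y ≢ x → x ≡ true × y ≡ false
∧-changed false y changed = ⊥-elim (changed refl)
∧-changed true false _ = refl , refl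
∧-changed true true changed = ⊥-elim (changed refl)

weighted-sum-< : ∀ {p q x y x′ y′} → p < q → x′ + y′ ≡ x + y → y′ < y → p * x′ + q * y′ < p * x + q * y
weighted-sum-< {p} {q} {x} {y} {x′} {y′} p<q x′+y′≡x+y y′<y = begin-strict
  p * x′ + q * y′          ≡⟨ cong (λ t → p * t + q * y′) x′≡x+d ⟩
  p * (x + d) + q * y′     ≡⟨ solve 5 (λ p q x y′ d → p :* (x :+ d) :+ q :* y′ := p :* x :+ q :* y′ :+ d :* p) refl p q x y′ d ⟩
  p * x + q * y′ + d * p   <⟨ +-monoʳ-< (p * x + q * y′) (*-monoʳ-< d {{>-nonZero (m<n⇒0<n∸m y′<y)}} p<q) ⟩
  p * x + q * y′ + d * q   ≡⟨ solve 5 (λ p q x y′ d → p :* x :+ q :* y′ :+ d :* q := p :* x :+ q :* (y′ :+ d)) refl p q x y′ d ⟩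
  p * x + q * (y′ + d)     ≡⟨ cong (λ t → p * x + q * t) y′+d≡y ⟩
  p * x + q * y            ∎
  where
  open ≤-Reasoning
  d = y ∸ y′
  y′+d≡y : y′ + d ≡ y
  y′+d≡y = m+[n∸m]≡n (<⇒≤ y′<y)
  x′≡x+d : x′ ≡ x + d
  x′≡x+d = +-cancelʳ-≡ y′ x′ (x + d) (begin-equality
    x′ + y′        ≡⟨ x′+y′≡x+y ⟩
    x + y          ≡⟨ cong (x +_) (sym y′+d≡y) ⟩
    x + (y′ + d)   ≡⟨ solve 3 (λ x y′ d → x :+ (y′ :+ d) := x :+ d :+ y′) refl x y′ d ⟩
    x + d + y′     ∎)

weight : ∀ {N} → Graph N → ℕ
weight {N} G = ∑[ a < N ] (toℕ a * degree G a)

-- The shift of j towards i: every edge {j, b} with {i, b} absent is replaced by {i, b}.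
module Shift {N : ℕ} (i j : Fin N) where

  data Role : Fin N → Set where
    at-i : Role i
    at-j : Role j
    elsewhere : ∀ {a} → a ≢ i → a ≢ j → Role a

  role : ∀ a → Role a
  role a with a ≟ᶠ i | a ≟ᶠ j
  ... | yes refl | _ = at-i
  ... | no _ | yes refl = at-j
  ... | no a≢i | no a≢j = elsewhere a≢i a≢j

  shifted : Graph N → ∀ {a b} → Role a → Role b → Bool
  shifted E at-i (elsewhere {b} _ _) = E i b ∨ E j b
  shifted E at-j (elsewhere {b} _ _) = E j b ∧ E i b
  shifted E (elsewhere {a} _ _) at-i = E a i ∨ E a j
  shifted E (elsewhere {a} _ _) at-j = E a j ∧ E a i
  shifted E {a} {b} _ _ = E a b

  shift : Graph N → Graph N
  shift E a b = shifted E (role a) (role b)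

  role-i : role i ≡ at-i
  role-i with i ≟ᶠ i
  ... | yes refl = refl
  ... | no i≢i = ⊥-elim (i≢i refl)

  module _ (i≢j : i ≢ j) where

    role-j : role j ≡ at-j
    role-j with j ≟ᶠ i | j ≟ᶠ j
    ... | yes j≡i | _ = ⊥-elim (i≢j (sym j≡i))
    ... | no _ | yes refl = refl
    ... | no _ | no j≢j = ⊥-elim (j≢j refl)

    open import Data.List.Membership.DecPropositional (_≟ᶠ_ {N}) using (_∈?_)

    module _ {E : Graph N} where

      shift-symmetric : Symmetric E → Symmetric (shift E)
      shift-symmetric E-sym a b with role a | role b
      ... | at-i | at-i = refl
      ... | at-i | at-j = E-sym i j
      ... | at-i | elsewhere _ _ = cong₂ _∨_ (E-sym i b) (E-sym j b)
      ... | at-j | at-i = E-sym j i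
      ... | at-j | at-j = refl
      ... | at-j | elsewhere _ _ = cong₂ _∧_ (E-sym j b) (E-sym i b)
      ... | elsewhere _ _ | at-i = cong₂ _∨_ (E-sym a i) (E-sym a j)
      ... | elsewhere _ _ | at-j = cong₂ _∧_ (E-sym a j) (E-sym a i)
      ... | elsewhere _ _ | elsewhere _ _ = E-sym a b

      shift-irreflexive : Irreflexive E → Irreflexive (shift E)
      shift-irreflexive E-irr a with role a
      ... | at-i = E-irr i
      ... | at-j = E-irr j
      ... | elsewhere _ _ = E-irr a

      shift-i : ∀ {b} → b ≢ i → b ≢ j → shift E i b ≡ (E i b ∨ E j b)
      shift-i {b} b≢i b≢j rewrite role-i with role b
      ... | at-i = ⊥-elim (b≢i refl)
      ... | at-j = ⊥-elim (b≢j refl)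
      ... | elsewhere _ _ = refl

      shift-j : ∀ {b} → b ≢ i → b ≢ j → shift E j b ≡ (E j b ∧ E i b)
      shift-j {b} b≢i b≢j rewrite role-j with role b
      ... | at-i = ⊥-elim (b≢i refl)
      ... | at-j = ⊥-elim (b≢j refl)
      ... | elsewhere _ _ = refl

      shift-elsewhere : ∀ {a b} → a ≢ i → a ≢ j → b ≢ i → b ≢ j → shift E a b ≡ E a b
      shift-elsewhere {a} {b} a≢i a≢j b≢i b≢j with role a | role b
      ... | at-i | _ = ⊥-elim (a≢i refl)
      ... | at-j | _ = ⊥-elim (a≢j refl)
      ... | elsewhere _ _ | at-i = ⊥-elim (b≢i refl)
      ... | elsewhere _ _ | at-j = ⊥-elim (b≢j refl)
      ... | elsewhere _ _ | elsewhere _ _ = refl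

      degree-shift-elsewhere : ∀ {a} → a ≢ i → a ≢ j → degree (shift E) a ≡ degree E a
      degree-shift-elsewhere {a} a≢i a≢j =
        sum-cong-off₂ i≢j (λ b b≢i b≢j → cong ⟦_⟧ (shift-elsewhere a≢i a≢j b≢i b≢j)) at-i-and-j
        where
        at-i-and-j : ⟦ shift E a i ⟧ + ⟦ shift E a j ⟧ ≡ ⟦ E a i ⟧ + ⟦ E a j ⟧
        at-i-and-j rewrite role-i | role-j with role a
        ... | at-i = ⊥-elim (a≢i refl)
        ... | at-j = ⊥-elim (a≢j refl)
        ... | elsewhere _ _ = ⟦∨⟧+⟦∧⟧ (E a i) (E a j)

      degree-shift-i+j : degree (shift E) i + degree (shift E) j ≡ degree E i + degree E j
      degree-shift-i+j = begin
        degree (shift E) i + degree (shift E) j      ≡⟨ sym (∑-distrib-+ (⟦_⟧ ∘ shift E i) (⟦_⟧ ∘ shift E j)) ⟩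
        ∑[ b < N ] (⟦ shift E i b ⟧ + ⟦ shift E j b ⟧) ≡⟨ sum-cong-≗ pointwise ⟩
        ∑[ b < N ] (⟦ E i b ⟧ + ⟦ E j b ⟧)             ≡⟨ ∑-distrib-+ (⟦_⟧ ∘ E i) (⟦_⟧ ∘ E j) ⟩
        degree E i + degree E j                      ∎
        where
        open ≡-Reasoning
        pointwise : ∀ b → ⟦ shift E i b ⟧ + ⟦ shift E j b ⟧ ≡ ⟦ E i b ⟧ + ⟦ E j b ⟧
        pointwise b rewrite role-i | role-j with role b
        ... | at-i = refl
        ... | at-j = refl
        ... | elsewhere _ _ = ⟦∨⟧+⟦∧⟧ (E i b) (E j b)

      degree-sum-shift : degree-sum (shift E) ≡ degree-sum E
      degree-sum-shift = sum-cong-off₂ i≢j (λ a a≢i a≢j → degree-shift-elsewhere a≢i a≢j) degree-shift-i+j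

      degree-j-shift-< : ∀ {c} → E j c ≡ true → shift E j c ≡ false → degree (shift E) j < degree E j
      degree-j-shift-< {c} Ejc Sjc = sum-mono-< pointwise c (subst₂ _<_ (cong ⟦_⟧ (sym Sjc)) (cong ⟦_⟧ (sym Ejc)) z<s)
        where
        pointwise : ∀ b → ⟦ shift E j b ⟧ ≤ ⟦ E j b ⟧
        pointwise b rewrite role-j with role b
        ... | at-i = ≤-refl
        ... | at-j = ≤-refl
        ... | elsewhere _ _ = ⟦∧⟧≤⟦⟧ (E j b) (E i b)

      removed-edge : ∀ {c} → c ≢ i → c ≢ j → E i c ≡ false × E j c ≡ true →
        ∃[ c′ ] E j c′ ≡ true × shift E j c′ ≡ false
      removed-edge {c} c≢i c≢j (Eic , Ejc) = c , Ejc , trans (shift-j c≢i c≢j) (cong₂ _∧_ Ejc Eic)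

      shift-changed : Symmetric E → ∀ {a b} → shift E a b ≢ E a b → ∃[ c ] E j c ≡ true × shift E j c ≡ false
      shift-changed E-sym {a} {b} changed with role a | role b
      ... | at-i | elsewhere b≢i b≢j = removed-edge b≢i b≢j (∨-changed (E i b) (E j b) changed)
      ... | at-j | elsewhere b≢i b≢j = removed-edge b≢i b≢j (swap (∧-changed (E j b) (E i b) changed))
      ... | elsewhere a≢i a≢j | at-i = let Eai , Eaj = ∨-changed (E a i) (E a j) changed in
        removed-edge a≢i a≢j (trans (E-sym i a) Eai , trans (E-sym j a) Eaj)
      ... | elsewhere a≢i a≢j | at-j = let Eaj , Eai = ∧-changed (E a j) (E a i) changed in
        removed-edge a≢i a≢j (trans (E-sym i a) Eai , trans (E-sym j a) Eaj)
      ... | at-i | at-i = ⊥-elim (changed refl)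
      ... | at-i | at-j = ⊥-elim (changed refl)
      ... | at-j | at-i = ⊥-elim (changed refl)
      ... | at-j | at-j = ⊥-elim (changed refl)
      ... | elsewhere _ _ | elsewhere _ _ = ⊥-elim (changed refl)

      weight-shift-< : toℕ i < toℕ j → Symmetric E → ∀ {a b} → shift E a b ≢ E a b → weight (shift E) < weight E
      weight-shift-< i<j E-sym changed with shift-changed E-sym changed
      ... | c , Ejc , Sjc = sum-<-off₂ i≢j (λ a a≢i a≢j → cong (toℕ a *_) (degree-shift-elsewhere a≢i a≢j))
        (weighted-sum-< i<j degree-shift-i+j (degree-j-shift-< Ejc Sjc))

      shift-edge-off-i : ∀ {c d} → Adj (shift E) c d → c ≢ i → d ≢ i → Adj E c d
      shift-edge-off-i {c} {d} cd c≢i d≢i with role c | role d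
      ... | at-i | _ = ⊥-elim (c≢i refl)
      ... | at-j | at-i = ⊥-elim (d≢i refl)
      ... | elsewhere _ _ | at-i = ⊥-elim (d≢i refl)
      ... | at-j | at-j = cd
      ... | at-j | elsewhere _ _ = proj₁ (∧-true⁻ cd)
      ... | elsewhere _ _ | at-j = proj₁ (∧-true⁻ cd)
      ... | elsewhere _ _ | elsewhere _ _ = cd

      shift-edge-at-i : ∀ {x} → Adj (shift E) i x → ¬ Adj E i x → x ≢ j × Adj E j x
      shift-edge-at-i {x} ix ¬Eix rewrite role-i with role x
      ... | at-i = ⊥-elim (¬Eix ix)
      ... | at-j = ⊥-elim (¬Eix ix)
      ... | elsewhere _ x≢j = x≢j , ∨-true⁻ ix ¬Eix

      shift-edge-at-j : ∀ {y} → Adj (shift E) j y → y ≢ i → y ≢ j → Adj E j y × Adj E i y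
      shift-edge-at-j {y} jy y≢i y≢j rewrite role-j with role y
      ... | at-i = ⊥-elim (y≢i refl)
      ... | at-j = ⊥-elim (y≢j refl)
      ... | elsewhere _ _ = ∧-true⁻ jy

      edges-off-i : ∀ M → i ∉ endpoints M → All (uncurry (Adj (shift E))) M → All (uncurry (Adj E)) M
      edges-off-i [] _ [] = []
      edges-off-i ((c , d) ∷ M) i∉cdM (cd ∷ cds) =
        shift-edge-off-i cd (i∉cdM ∘ here ∘ sym) (i∉cdM ∘ there ∘ here ∘ sym) ∷ edges-off-i M (i∉cdM ∘ there ∘ there) cds

      -- i is matched to x by an edge the shift created: x takes j as its new partner,
      -- and i takes over the old partner y of j, which the shift shows adjacent to i.
      reroute : Symmetric E → ∀ {M x} → IsMatching (shift E) M → Unique (i ∷ x ∷ endpoints M) →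
        x ≢ j → Adj E j x → Matching E (suc (length M))
      reroute E-sym {M} {x} isM ixM x≢j Ejx with j ∈? endpoints M
      ... | no j∉M = (j , x) ∷ M , refl , isMatching (fresh-∷ j∉xM (AllPairs.tail ixM)) (Ejx ∷ edges-off-i M i∉M (edges isM))
        where
        i∉M = Unique-∷⇒∉ ixM ∘ there
        j∉xM : j ∉ x ∷ endpoints M
        j∉xM (here j≡x) = x≢j (sym j≡x)
        j∉xM (there j∈M) = j∉M j∈M
      ... | yes j∈M with partnered (shift-symmetric E-sym) isM j∈M
      ... | record { partner = y ; others = M′ ; size = size ; adjacent = jy ; others-matching = isM′ ; reorder = reorder } =
        (j , x) ∷ (i , y) ∷ M′ , cong suc (sym size) , isMatching jxiyM′ (Ejx ∷ proj₂ Ejy×Eiy ∷ edges-off-i M′ i∉M′ (edges isM′))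
        where
        ixjyM′ : Unique (i ∷ x ∷ j ∷ y ∷ endpoints M′)
        ixjyM′ = unique-resp-↭ (↭-prep i (↭-prep x reorder)) ixM
        jxiyM′ : Unique (j ∷ x ∷ i ∷ y ∷ endpoints M′)
        jxiyM′ = unique-resp-↭ (↭-trans (↭-swap i x ↭-refl) (↭-trans (↭-prep x (↭-swap i j ↭-refl)) (↭-swap x j ↭-refl))) ixjyM′
        i∉M′ = Unique-∷⇒∉ ixjyM′ ∘ there ∘ there ∘ there
        y≢i : y ≢ i
        y≢i y≡i = Unique-∷⇒∉ ixjyM′ (there (there (here (sym y≡i))))
        y≢j : y ≢ j
        y≢j y≡j = Unique-∷⇒∉ (AllPairs.tail (AllPairs.tail ixjyM′)) (here (sym y≡j))
        Ejy×Eiy = shift-edge-at-j jy y≢i y≢j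

      unshift-matching : Symmetric E → ∀ {k} → Matching (shift E) k → Matching E k
      unshift-matching E-sym (M , refl , isM) with i ∈? endpoints M
      ... | no i∉M = M , refl , isMatching (disjoint isM) (edges-off-i M i∉M (edges isM))
      ... | yes i∈M with partnered (shift-symmetric E-sym) isM i∈M
      ... | record { partner = x ; others = M′ ; size = size ; adjacent = ix ; others-matching = isM′ ; reorder = reorder }
          = subst (Matching E) (sym size) matched
        where
        ixM′ : Unique (i ∷ x ∷ endpoints M′)
        ixM′ = unique-resp-↭ reorder (disjoint isM)
        matched : Matching E (suc (length M′))
        matched with adj? E i x
        ... | yes Eix = (i , x) ∷ M′ , refl , isMatching ixM′ (Eix ∷ edges-off-i M′ (Unique-∷⇒∉ ixM′ ∘ there) (edges isM′))
        ... | no ¬Eix = let x≢j , Ejx = shift-edge-at-i ix ¬Eix in reroute E-sym isM′ ixM′ x≢j Ejx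

-- Stable graphs and the Erdős–Gallai theorem

open Shift using (shift)

Stable : ∀ {N} → Graph N → Set
Stable {N} E = ∀ (i j : Fin N) → toℕ i < toℕ j → ∀ a b → shift i j E a b ≡ E a b

toℕ<⇒≢ : ∀ {N} {i j : Fin N} → toℕ i < toℕ j → i ≢ j
toℕ<⇒≢ i<j i≡j = <-irrefl (cong toℕ i≡j) i<j

module _ {N : ℕ} where

  Unstable : Graph N → Set
  Unstable E = ∃[ i ] ∃[ j ] ∃[ a ] ∃[ b ] toℕ i < toℕ j × shift i j E a b ≢ E a b

  stable? : ∀ E → Stable E ⊎ Unstable E
  stable? E with any? (λ i → any? (λ j → any? (λ a → any? (λ b → (toℕ i <? toℕ j) ×-dec ¬? (shift i j E a b ≟ᵇ E a b)))))
  ... | yes unstable = inj₂ unstable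
  ... | no none = inj₁ λ i j i<j a b → decidable-stable (shift i j E a b ≟ᵇ E a b) λ changed → none (i , j , a , b , i<j , changed)

  record Compression (E : Graph N) : Set where
    field
      graph : Graph N
      symmetric : Symmetric graph
      irreflexive : Irreflexive graph
      stable : Stable graph
      degree-sum≡ : degree-sum graph ≡ degree-sum E
      pull-back : ∀ {k} → Matching graph k → Matching E k

  -- Shifting terminates because every effective shift lowers the weight.
  compress : ∀ E → Symmetric E → Irreflexive E → Compression E
  compress E E-sym E-irr = go E E-sym E-irr (<-wellFounded (weight E))
    where
    go : ∀ E → Symmetric E → Irreflexive E → Acc _<_ (weight E) → Compression E
    go E E-sym E-irr (acc smaller) with stable? E
    ... | inj₁ E-stable = record
      { graph = E ; symmetric = E-sym ; irreflexive = E-irr ; stable = E-stable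
      ; degree-sum≡ = refl ; pull-back = λ M → M }
    ... | inj₂ (i , j , a , b , i<j , changed) = record
      { graph = graph ; symmetric = symmetric ; irreflexive = irreflexive ; stable = stable
      ; degree-sum≡ = trans degree-sum≡ (Shift.degree-sum-shift i j i≢j)
      ; pull-back = Shift.unshift-matching i j i≢j E-sym ∘ pull-back }
      where
      i≢j = toℕ<⇒≢ i<j
      open Compression (go (shift i j E) (Shift.shift-symmetric i j i≢j E-sym) (Shift.shift-irreflexive i j i≢j E-irr)
                           (smaller (Shift.weight-shift-< i j i≢j i<j E-sym changed)))

  stable-downward : ∀ {E : Graph N} → Stable E → Irreflexive E → ∀ {a b a′} →
    E a b ≡ true → toℕ a′ < toℕ a → a′ ≢ b → E a′ b ≡ true
  stable-downward {E} E-stable E-irr {a} {b} {a′} Eab a′<a a′≢b = begin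
    E a′ b            ≡⟨ sym (E-stable a′ a a′<a a′ b) ⟩
    shift a′ a E a′ b ≡⟨ Shift.shift-i a′ a (toℕ<⇒≢ a′<a) {E} (a′≢b ∘ sym) b≢a ⟩
    E a′ b ∨ E a b    ≡⟨ cong (E a′ b ∨_) Eab ⟩
    E a′ b ∨ true     ≡⟨ ∨-zeroʳ (E a′ b) ⟩
    true              ∎
    where
    open ≡-Reasoning
    b≢a : b ≢ a
    b≢a refl with trans (sym (E-irr a)) Eab
    ... | ()

count-below : ∀ {N} t → t ≤ N → ∑[ b < N ] ⟦ does (toℕ b <? t) ⟧ ≡ t
count-below {N} t t≤N = subst (λ m → ∑[ b < m ] ⟦ does (toℕ b <? t) ⟧ ≡ t) (m+[n∸m]≡n t≤N) (begin
  ∑[ b < t + (N ∸ t) ] ⟦ does (toℕ b <? t) ⟧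
    ≡⟨ sum-toℕ-+ t (N ∸ t) (λ b → ⟦ does (b <? t) ⟧) ⟩
  ∑[ b < t ] ⟦ does (toℕ b <? t) ⟧ + ∑[ b < N ∸ t ] ⟦ does (t + toℕ b <? t) ⟧
    ≡⟨ cong₂ _+_ (sum-toℕ-const t 1 _ (λ b b<t → cong ⟦_⟧ (dec-true (b <? t) b<t)))
                 (sum-toℕ-const (N ∸ t) 0 _ (λ b _ → cong ⟦_⟧ (dec-false (t + b <? t) (m+n≮m t b)))) ⟩
  t * 1 + (N ∸ t) * 0
    ≡⟨ cong₂ _+_ (*-identityʳ t) (*-zeroʳ (N ∸ t)) ⟩
  t + 0
    ≡⟨ +-identityʳ t ⟩
  t ∎)
  where open ≡-Reasoning

module _ {N : ℕ} {E : Graph N} (E-irr : Irreflexive E) where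

  degree-≤ : ∀ {a t} → t ≤ N → (∀ {b} → E a b ≡ true → toℕ b < t) → degree E a ≤ t
  degree-≤ {a} {t} t≤N nbrs<t = begin
    degree E a                        ≤⟨ sum-mono-≤ pointwise ⟩
    ∑[ b < N ] ⟦ does (toℕ b <? t) ⟧  ≡⟨ count-below t t≤N ⟩
    t                                 ∎
    where
    open ≤-Reasoning
    pointwise : ∀ b → ⟦ E a b ⟧ ≤ ⟦ does (toℕ b <? t) ⟧
    pointwise b with E a b in Eab
    ... | false = z≤n
    ... | true = ≤-reflexive (cong ⟦_⟧ (sym (dec-true (toℕ b <? t) (nbrs<t Eab))))

  degree-< : ∀ {a t} → toℕ a < t → t ≤ N → (∀ {b} → E a b ≡ true → toℕ b < t) → suc (degree E a) ≤ t
  degree-< {a} {t} a<t t≤N nbrs<t = begin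
    suc (degree E a)                 ≤⟨ s≤s (sum-mono-≤ pointwise) ⟩
    suc (sum (erase a below))        ≡⟨ cong (_+ sum (erase a below)) (sym (cong ⟦_⟧ (dec-true (toℕ a <? t) a<t))) ⟩
    below a + sum (erase a below)    ≡⟨ sym (sum-erase a below) ⟩
    sum below                        ≡⟨ count-below t t≤N ⟩
    t                                ∎
    where
    open ≤-Reasoning
    below : Fin N → ℕ
    below b = ⟦ does (toℕ b <? t) ⟧
    pointwise : ∀ b → ⟦ E a b ⟧ ≤ erase a below b
    pointwise b with b ≟ᶠ a
    ... | yes refl = ≤-trans (≤-reflexive (cong ⟦_⟧ (E-irr b))) z≤n
    ... | no b≢a with E a b in Eab
    ...   | false = z≤n
    ...   | true = ≤-reflexive (trans (cong ⟦_⟧ (sym (dec-true (toℕ b <? t) (nbrs<t Eab)))) (sym (updateAt-minimal b a below b≢a)))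

module _ {N : ℕ} {E : Graph N} (E-sym : Symmetric E) (E-irr : Irreflexive E) (E-stable : Stable E) where

  stable-downward-≤ : ∀ {a b c} → E a b ≡ true → toℕ c ≤ toℕ a → c ≢ b → E c b ≡ true
  stable-downward-≤ {a} {b} {c} Eab c≤a c≢b with m≤n⇒m<n∨m≡n c≤a
  ... | inj₁ c<a = stable-downward E-stable E-irr Eab c<a c≢b
  ... | inj₂ c≡a = subst (λ x → E x b ≡ true) (toℕ-injective (sym c≡a)) Eab

  module _ {u w : Fin N} (u<w : toℕ u < toℕ w) (¬uw : E u w ≢ true) where

    -- Both endpoints of such an edge could be moved down to u and w.
    no-late-edge : ∀ {a b} → E a b ≡ true → toℕ u ≤ toℕ a → toℕ w ≤ toℕ b → ⊥
    no-late-edge {a} {b} Eab u≤a w≤b = ¬uw (trans (E-sym u w) Ewu)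
      where
      u≢b : u ≢ b
      u≢b refl = <⇒≱ u<w w≤b
      w≢u : w ≢ u
      w≢u w≡u = <-irrefl (cong toℕ (sym w≡u)) u<w
      Ewu : E w u ≡ true
      Ewu = stable-downward-≤ (trans (E-sym b u) (stable-downward-≤ Eab u≤a u≢b)) w≤b w≢u

    neighbour-<w : ∀ {a b} → toℕ u ≤ toℕ a → E a b ≡ true → toℕ b < toℕ w
    neighbour-<w u≤a Eab = ≰⇒> (no-late-edge Eab u≤a)

    neighbour-<u : ∀ {a b} → toℕ w ≤ toℕ a → E a b ≡ true → toℕ b < toℕ u
    neighbour-<u {a} {b} w≤a Eab = ≰⇒> (λ u≤b → no-late-edge (trans (E-sym b a) Eab) u≤b w≤a)

    module _ {p d s} (u≡p : toℕ u ≡ p) (w≡p+1+d : toℕ w ≡ p + suc d) (N≡ : N ≡ p + suc d + s) where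

      -- A vertex before u may be adjacent to all others, one before w only to vertices
      -- before w, and any other vertex only to vertices before u.
      private
        cap : ℕ → ℕ
        cap t with t <? p | t <? p + suc d
        ... | yes _ | _ = p + d + s
        ... | no _ | yes _ = p + d
        ... | no _ | no _ = p

        N≡1+p+d+s : N ≡ suc (p + d + s)
        N≡1+p+d+s = trans N≡ (cong (_+ s) (+-suc p d))

        degree-≤-cap : ∀ a → degree E a ≤ cap (toℕ a)
        degree-≤-cap a with toℕ a <? p | toℕ a <? p + suc d
        ... | yes _ | _ = s≤s⁻¹ (subst (suc (degree E a) ≤_) N≡1+p+d+s (degree-< {E = E} E-irr (toℕ<n a) ≤-refl (λ {b} _ → toℕ<n b)))
        ... | no a≮p | yes a<p+1+d = s≤s⁻¹ (subst (suc (degree E a) ≤_) (+-suc p d) (degree-< {E = E} E-irr a<p+1+d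
              (subst (p + suc d ≤_) (sym N≡) (m≤m+n (p + suc d) s))
              (λ Eab → subst (_ <_) w≡p+1+d (neighbour-<w (subst (_≤ toℕ a) (sym u≡p) (≮⇒≥ a≮p)) Eab))))
        ... | no _ | no a≮p+1+d = degree-≤ {E = E} E-irr (subst (p ≤_) (sym N≡) (≤-trans (m≤m+n p (suc d)) (m≤m+n (p + suc d) s)))
              (λ Eab → subst (_ <_) u≡p (neighbour-<u (subst (_≤ toℕ a) (sym w≡p+1+d) (≮⇒≥ a≮p+1+d)) Eab))

        cap-sum : ∀ m → m ≡ p + (suc d + s) → ∑[ a < m ] cap (toℕ a) ≡ p * (p + d + s) + (suc d * (p + d) + s * p)
        cap-sum _ refl = begin
          ∑[ a < p + (suc d + s) ] cap (toℕ a)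
            ≡⟨ sum-toℕ-+ p (suc d + s) cap ⟩
          ∑[ t < p ] cap (toℕ t) + ∑[ t < suc d + s ] cap (p + toℕ t)
            ≡⟨ cong (∑[ t < p ] cap (toℕ t) +_) (sum-toℕ-+ (suc d) s (cap ∘ (p +_))) ⟩
          ∑[ t < p ] cap (toℕ t) + (∑[ t < suc d ] cap (p + toℕ t) + ∑[ t < s ] cap (p + (suc d + toℕ t)))
            ≡⟨ cong₂ _+_ (sum-toℕ-const p _ cap early) (cong₂ _+_ (sum-toℕ-const (suc d) _ _ middle) (sum-toℕ-const s _ _ late)) ⟩
          p * (p + d + s) + (suc d * (p + d) + s * p) ∎
          where
          open ≡-Reasoning
          early : ∀ t → t < p → cap t ≡ p + d + s
          early t t<p with t <? p
          ... | yes _ = refl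
          ... | no t≮p = ⊥-elim (t≮p t<p)
          middle : ∀ t → t < suc d → cap (p + t) ≡ p + d
          middle t t<1+d with p + t <? p | p + t <? p + suc d
          ... | yes p+t<p | _ = ⊥-elim (m+n≮m p t p+t<p)
          ... | no _ | yes _ = refl
          ... | no _ | no ≮ = ⊥-elim (≮ (+-monoʳ-< p t<1+d))
          late : ∀ t → t < s → cap (p + (suc d + t)) ≡ p
          late t _ with p + (suc d + t) <? p | p + (suc d + t) <? p + suc d
          ... | yes lt | _ = ⊥-elim (m+n≮m p _ lt)
          ... | no _ | yes lt = ⊥-elim (<⇒≱ lt (≤-trans (m≤m+n (p + suc d) t) (≤-reflexive (+-assoc p (suc d) t))))
          ... | no _ | no _ = refl

      degree-sum-≤ : degree-sum E ≤ p * (p + d + s) + suc d * (p + d) + s * p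
      degree-sum-≤ = begin
        degree-sum E            ≤⟨ sum-mono-≤ degree-≤-cap ⟩
        ∑[ a < N ] cap (toℕ a)  ≡⟨ cap-sum N (trans N≡ (+-assoc p (suc d) s)) ⟩
        p * (p + d + s) + (suc d * (p + d) + s * p) ≡⟨ sym (+-assoc (p * (p + d + s)) _ _) ⟩
        p * (p + d + s) + suc d * (p + d) + s * p   ∎
        where open ≤-Reasoning

-- With k = K + 1 and N = 2k + r vertices: twice the number of edges of a clique on 2k - 1
-- vertices, and of the graph in which K vertices are adjacent to all others.
clique-bound : ℕ → ℕ
clique-bound K = (K + K + 1) * (K + K)

star-bound : ℕ → ℕ → ℕ
star-bound K r = K * (K + K + K + 3 + (r + r))

-- The bound of degree-sum-≤ when the pair {t, t + 2j + 1} is missing and K = t + j.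
missing-pair-count : ℕ → ℕ → ℕ → ℕ
missing-pair-count t j r = t * (t + (j + j) + suc (t + r)) + suc (j + j) * (t + (j + j)) + suc (t + r) * t

-- The count is convex in the position t of the missing pair; it equals clique-bound
-- at t = 0 and star-bound at t = K.
missing-pair-count-interpolates : ∀ t j r →
  j * clique-bound (t + j) + t * star-bound (t + j) r ≡ (t + j) * missing-pair-count t j r + 3 * t * j * (t + j)
missing-pair-count-interpolates = solve 3 (λ t j r →
  j :* ((t :+ j :+ (t :+ j) :+ con 1) :* (t :+ j :+ (t :+ j)))
    :+ t :* ((t :+ j) :* (t :+ j :+ (t :+ j) :+ (t :+ j) :+ con 3 :+ (r :+ r)))
  := (t :+ j) :* (t :* (t :+ (j :+ j) :+ (con 1 :+ (t :+ r))) :+ (con 1 :+ (j :+ j)) :* (t :+ (j :+ j))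
                  :+ (con 1 :+ (t :+ r)) :* t)
     :+ con 3 :* t :* j :* (t :+ j)) refl

missing-pair-count-scaled : ∀ t j r →
  (t + j) * missing-pair-count t j r ≤ (t + j) * (clique-bound (t + j) ⊔ star-bound (t + j) r)
missing-pair-count-scaled t j r = begin
  (t + j) * missing-pair-count t j r                          ≤⟨ m≤m+n _ _ ⟩
  (t + j) * missing-pair-count t j r + 3 * t * j * (t + j)    ≡⟨ sym (missing-pair-count-interpolates t j r) ⟩
  j * clique-bound (t + j) + t * star-bound (t + j) r         ≤⟨ +-mono-≤ (*-monoʳ-≤ j (m≤m⊔n _ _)) (*-monoʳ-≤ t (m≤n⊔m _ _)) ⟩
  j * bound + t * bound                                       ≡⟨ trans (+-comm (j * bound) (t * bound)) (sym (*-distribʳ-+ bound t j)) ⟩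
  (t + j) * bound                                             ∎
  where
  open ≤-Reasoning
  bound = clique-bound (t + j) ⊔ star-bound (t + j) r

missing-pair-count-≤ : ∀ t j r → missing-pair-count t j r ≤ clique-bound (t + j) ⊔ star-bound (t + j) r
missing-pair-count-≤ zero zero r = ≤-reflexive (*-zeroʳ r)
missing-pair-count-≤ (suc t) j r = *-cancelˡ-≤ (suc t + j) (missing-pair-count-scaled (suc t) j r)
missing-pair-count-≤ zero (suc j) r = *-cancelˡ-≤ (suc j) (missing-pair-count-scaled zero (suc j) r)

module _ {N K r : ℕ} (N≡ : N ≡ suc K + suc K + r) where

  module _ {E : Graph N} (E-sym : Symmetric E) (E-irr : Irreflexive E) (E-stable : Stable E) where

    missing-pair-bound : ∀ {t j u w} → t + j ≡ K → toℕ u ≡ t → toℕ w ≡ K + suc j → E u w ≢ true →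
      degree-sum E ≤ clique-bound K ⊔ star-bound K r
    missing-pair-bound {t} {j} {u} {w} refl u≡t w≡K+1+j ¬uw =
      ≤-trans (degree-sum-≤ E-sym E-irr E-stable u<w ¬uw u≡t w≡ N≡′) (missing-pair-count-≤ t j r)
      where
      w≡ : toℕ w ≡ t + suc (j + j)
      w≡ = trans w≡K+1+j (solve 2 (λ t j → t :+ j :+ (con 1 :+ j) := t :+ (con 1 :+ (j :+ j))) refl t j)
      u<w : toℕ u < toℕ w
      u<w = subst₂ _<_ (sym u≡t) (sym w≡) (m<m+n t z<s)
      N≡′ : N ≡ t + suc (j + j) + suc (t + r)
      N≡′ = trans N≡ (solve 3 (λ t j r → (con 1 :+ (t :+ j)) :+ (con 1 :+ (t :+ j)) :+ r
                                     := t :+ (con 1 :+ (j :+ j)) :+ (con 1 :+ (t :+ r))) refl t j r)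

    private
      t≤K : ∀ (t : Fin (suc K)) → toℕ t ≤ K
      t≤K t = s≤s⁻¹ (toℕ<n t)

      2K+2≤N : suc K + suc K ≤ N
      2K+2≤N = subst (suc K + suc K ≤_) (sym N≡) (m≤m+n (suc K + suc K) r)

      α : Fin (suc K) → Fin N
      α t = fromℕ< (<-≤-trans (toℕ<n t) (≤-trans (m≤m+n (suc K) (suc K)) 2K+2≤N))

      β : Fin (suc K) → Fin N
      β t = fromℕ< {K + suc (K ∸ toℕ t)} (≤-trans (+-monoʳ-≤ (suc K) (s≤s (m∸n≤m K (toℕ t)))) 2K+2≤N)

      α-injective : ∀ {x y} → α x ≡ α y → x ≡ y
      α-injective {x} {y} αx≡αy = toℕ-injective (begin-equality
        toℕ x      ≡⟨ sym (toℕ-fromℕ< _) ⟩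
        toℕ (α x)  ≡⟨ cong toℕ αx≡αy ⟩
        toℕ (α y)  ≡⟨ toℕ-fromℕ< _ ⟩
        toℕ y      ∎)
        where open ≤-Reasoning

      β-injective : ∀ {x y} → β x ≡ β y → x ≡ y
      β-injective {x} {y} βx≡βy = toℕ-injective (∸-cancelˡ-≡ (t≤K x) (t≤K y) (suc-injective (+-cancelˡ-≡ K _ _ (begin-equality
        K + suc (K ∸ toℕ x)  ≡⟨ sym (toℕ-fromℕ< _) ⟩
        toℕ (β x)            ≡⟨ cong toℕ βx≡βy ⟩
        toℕ (β y)            ≡⟨ toℕ-fromℕ< _ ⟩
        K + suc (K ∸ toℕ y)  ∎))))
        where open ≤-Reasoning

      α≢β : ∀ x y → α x ≢ β y
      α≢β x y αx≡βy = <⇒≢ (≤-<-trans (t≤K x) (m<m+n K z<s)) (begin-equality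
        toℕ x                ≡⟨ sym (toℕ-fromℕ< _) ⟩
        toℕ (α x)            ≡⟨ cong toℕ αx≡βy ⟩
        toℕ (β y)            ≡⟨ toℕ-fromℕ< _ ⟩
        K + suc (K ∸ toℕ y)  ∎)
        where open ≤-Reasoning

    -- The pairs {t, 2K + 1 - t} for t ≤ K form a matching unless one of them is missing.
    matching-or-bound : Matching E (suc K) ⊎ degree-sum E ≤ clique-bound K ⊔ star-bound K r
    matching-or-bound with all? (λ t → E (α t) (β t) ≟ᵇ true)
    ... | yes pairs = inj₁ (matching-of-family record
      { left = α ; right = β
      ; left-injective = α-injective ; right-injective = β-injective ; left≢right = α≢β
      ; adjacent = pairs })
    ... | no ¬pairs with ¬∀⟶∃¬ (suc K) _ (λ t → E (α t) (β t) ≟ᵇ true) ¬pairs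
    ... | t , missing = inj₂ (missing-pair-bound (m+[n∸m]≡n (t≤K t)) (toℕ-fromℕ< _) (toℕ-fromℕ< _) missing)

  erdős-gallai : ∀ {E : Graph N} → Symmetric E → Irreflexive E →
    clique-bound K ⊔ star-bound K r < degree-sum E → Matching E (suc K)
  erdős-gallai {E} E-sym E-irr many-edges =
    [ pull-back , (λ few-edges → ⊥-elim (<⇒≱ many-edges (subst (_≤ _) degree-sum≡ few-edges))) ]′
      (matching-or-bound symmetric irreflexive stable)
    where open Compression (compress E E-sym E-irr)

-- 3-graphs and links

∈-allSubsets : ∀ {n} (S : Subset n) → S ∈ allSubsets n
∈-allSubsets [] = here refl
∈-allSubsets {suc n} (outside ∷ S) = ∈-++⁺ˡ (∈-map⁺ (outside ∷_) (∈-allSubsets S))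
∈-allSubsets {suc n} (inside ∷ S) = ∈-++⁺ʳ (map (outside ∷_) (allSubsets n)) (∈-map⁺ (inside ∷_) (∈-allSubsets S))

allSubsets-unique : ∀ n → Unique (allSubsets n)
allSubsets-unique zero = [] ∷ []
allSubsets-unique (suc n) =
  ++⁺ (map⁺ ∷-injectiveʳ (allSubsets-unique n)) (map⁺ ∷-injectiveʳ (allSubsets-unique n)) halves-disjoint
  where
  halves-disjoint : ∀ {S} → ¬ (S ∈ map (outside ∷_) (allSubsets n) × S ∈ map (inside ∷_) (allSubsets n))
  halves-disjoint (S∈out , S∈in) with ∈-map⁻ (outside ∷_) S∈out | ∈-map⁻ (inside ∷_) S∈in
  ... | _ , _ , refl | _ , _ , ()

minList-≤ : ∀ {x} xs → x ∈ xs → minList xs ≤ x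
minList-≤ (x ∷ []) (here refl) = ≤-refl
minList-≤ (x ∷ y ∷ xs) (here refl) = m⊓n≤m x _
minList-≤ (x ∷ y ∷ xs) (there x∈) = ≤-trans (m⊓n≤n x _) (minList-≤ (y ∷ xs) x∈)

δ≤deg : ∀ {n} i (G : Graph3 n) (S : Subset n) → ∣ S ∣ ≡ i → δ i G ≤ deg G S
δ≤deg i G S ∣S∣≡i = minList-≤ _ (∈-map⁺ (deg G) (∈-filter⁺ (λ S → ∣ S ∣ ≟ i) (∈-allSubsets S) ∣S∣≡i))

∣p∣≡1+∣p-x∣ : ∀ {n} (p : Subset n) {x} → x ∈ˢ p → ∣ p ∣ ≡ suc ∣ p - x ∣
∣p∣≡1+∣p-x∣ (inside ∷ p) hereˢ = cong suc (cong ∣_∣ (sym (p─⊥≡p p)))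
∣p∣≡1+∣p-x∣ (inside ∷ p) (thereˢ x∈p) = cong suc (∣p∣≡1+∣p-x∣ p x∈p)
∣p∣≡1+∣p-x∣ (outside ∷ p) (thereˢ x∈p) = ∣p∣≡1+∣p-x∣ p x∈p

x∉p-x : ∀ {n} (p : Subset n) x → x ∉ˢ p - x
x∉p-x (s ∷ p) zero ()
x∉p-x (s ∷ p) (suc x) (thereˢ x∈) = x∉p-x p x x∈

module _ {n : ℕ} where

  ∈-remove⁻ : ∀ {p : Subset n} {x y} → y ∈ˢ p - x → y ∈ˢ p × y ≢ x
  ∈-remove⁻ {p} {x} y∈ = p─q⊆p p ⁅ x ⁆ y∈ , λ { refl → x∉p-x p x y∈ }

  ∣p∣≡0⇒∉ : ∀ (p : Subset n) {x} → ∣ p ∣ ≡ 0 → x ∉ˢ p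
  ∣p∣≡0⇒∉ p ∣p∣≡0 x∈p with trans (sym ∣p∣≡0) (∣p∣≡1+∣p-x∣ p x∈p)
  ... | ()

  ∣p∣≡1+m⇒∈ : ∀ (p : Subset n) {m} → ∣ p ∣ ≡ suc m → ∃[ x ] x ∈ˢ p
  ∣p∣≡1+m⇒∈ p ∣p∣≡1+m with nonempty? p
  ... | yes nonempty = nonempty
  ... | no empty with trans (sym ∣p∣≡1+m) (trans (cong ∣_∣ (Empty-unique empty)) (∣⊥∣≡0 n))
  ...   | ()

  another-element : ∀ {T : Subset n} {v} → ∣ T ∣ ≡ 3 → v ∈ˢ T → ∃[ u ] u ∈ˢ T × u ≢ v
  another-element {T} {v} ∣T∣≡3 v∈T with ∣p∣≡1+m⇒∈ (T - v) (suc-injective (trans (sym (∣p∣≡1+∣p-x∣ T v∈T)) ∣T∣≡3))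
  ... | u , u∈T-v = u , ∈-remove⁻ u∈T-v

  third-element : ∀ {T : Subset n} {v u} → ∣ T ∣ ≡ 3 → v ∈ˢ T → u ∈ˢ T → u ≢ v →
    ∃[ y ] y ≢ v × y ≢ u × T ≡ ⁅ v ⁆ ∪ ⁅ u ⁆ ∪ ⁅ y ⁆
  third-element {T} {v} {u} ∣T∣≡3 v∈T u∈T u≢v = y , y≢v , y≢u , ⊆-antisym T⊆vuy vuy⊆T
    where
    u∈T-v = x∈p∧x≢y⇒x∈p-y u∈T u≢v
    ∣T-v-u∣≡1 : ∣ T - v - u ∣ ≡ 1
    ∣T-v-u∣≡1 = suc-injective (trans (sym (∣p∣≡1+∣p-x∣ (T - v) u∈T-v))
                  (suc-injective (trans (sym (∣p∣≡1+∣p-x∣ T v∈T)) ∣T∣≡3)))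
    y-found = ∣p∣≡1+m⇒∈ (T - v - u) ∣T-v-u∣≡1
    y = proj₁ y-found
    y∈T-v-u = proj₂ y-found
    y∈T-v×y≢u = ∈-remove⁻ y∈T-v-u
    y∈T×y≢v = ∈-remove⁻ (proj₁ y∈T-v×y≢u)
    y≢u = proj₂ y∈T-v×y≢u
    y≢v = proj₂ y∈T×y≢v
    ∣T-v-u-y∣≡0 : ∣ T - v - u - y ∣ ≡ 0
    ∣T-v-u-y∣≡0 = suc-injective (trans (sym (∣p∣≡1+∣p-x∣ (T - v - u) y∈T-v-u)) ∣T-v-u∣≡1)
    T⊆vuy : T ⊆ˢ ⁅ v ⁆ ∪ ⁅ u ⁆ ∪ ⁅ y ⁆
    T⊆vuy {z} z∈T with z ≟ᶠ v | z ≟ᶠ u | z ≟ᶠ y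
    ... | yes refl | _ | _ = x∈p∪q⁺ (inj₁ (x∈⁅x⁆ z))
    ... | no _ | yes refl | _ = x∈p∪q⁺ (inj₂ (x∈p∪q⁺ (inj₁ (x∈⁅x⁆ z))))
    ... | no _ | no _ | yes refl = x∈p∪q⁺ (inj₂ (x∈p∪q⁺ (inj₂ (x∈⁅x⁆ z))))
    ... | no z≢v | no z≢u | no z≢y = ⊥-elim (∣p∣≡0⇒∉ (T - v - u - y) ∣T-v-u-y∣≡0
          (x∈p∧x≢y⇒x∈p-y (x∈p∧x≢y⇒x∈p-y (x∈p∧x≢y⇒x∈p-y z∈T z≢v) z≢u) z≢y))
    vuy⊆T : ⁅ v ⁆ ∪ ⁅ u ⁆ ∪ ⁅ y ⁆ ⊆ˢ T
    vuy⊆T {z} z∈vuy with x∈p∪q⁻ ⁅ v ⁆ _ z∈vuy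
    ... | inj₁ z∈v = subst (_∈ˢ T) (sym (x∈⁅y⁆⇒x≡y v z∈v)) v∈T
    ... | inj₂ z∈uy with x∈p∪q⁻ ⁅ u ⁆ _ z∈uy
    ...   | inj₁ z∈u = subst (_∈ˢ T) (sym (x∈⁅y⁆⇒x≡y u z∈u)) u∈T
    ...   | inj₂ z∈y = subst (_∈ˢ T) (sym (x∈⁅y⁆⇒x≡y y z∈y)) (proj₁ y∈T×y≢v)

  ∣⁅x⁆∪⁅y⁆∣≡2 : ∀ {x y : Fin n} → x ≢ y → ∣ ⁅ x ⁆ ∪ ⁅ y ⁆ ∣ ≡ 2
  ∣⁅x⁆∪⁅y⁆∣≡2 {x} {y} x≢y = trans (∣p∣≡1+∣p-x∣ (⁅ x ⁆ ∪ ⁅ y ⁆) (x∈p∪q⁺ (inj₁ (x∈⁅x⁆ x))))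
    (cong suc (trans (cong ∣_∣ xy-x≡y) (∣⁅x⁆∣≡1 y)))
    where
    xy-x≡y : ⁅ x ⁆ ∪ ⁅ y ⁆ - x ≡ ⁅ y ⁆
    xy-x≡y = ⊆-antisym ⊆y y⊆
      where
      ⊆y : ⁅ x ⁆ ∪ ⁅ y ⁆ - x ⊆ˢ ⁅ y ⁆
      ⊆y z∈ with ∈-remove⁻ {p = ⁅ x ⁆ ∪ ⁅ y ⁆} z∈
      ... | z∈xy , z≢x with x∈p∪q⁻ ⁅ x ⁆ _ z∈xy
      ...   | inj₁ z∈x = ⊥-elim (z≢x (x∈⁅y⁆⇒x≡y x z∈x))
      ...   | inj₂ z∈y = z∈y
      y⊆ : ⁅ y ⁆ ⊆ˢ ⁅ x ⁆ ∪ ⁅ y ⁆ - x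
      y⊆ {z} z∈y = x∈p∧x≢y⇒x∈p-y (x∈p∪q⁺ (inj₂ z∈y)) (λ z≡x → x≢y (trans (sym z≡x) (x∈⁅y⁆⇒x≡y y z∈y)))

module _ {n : ℕ} (G : Graph3 n) where

  isEdgeᵇ⇒IsEdge : ∀ {S} → isEdgeᵇ G S ≡ true → IsEdge G S
  isEdgeᵇ⇒IsEdge {S} e with ∧-true⁻ {∣ S ∣ ≡ᵇ 3} e
  ... | ∣S∣≡ᵇ3 , edge-S = ≡ᵇ⇒≡ ∣ S ∣ 3 (subst T (sym ∣S∣≡ᵇ3) _) , edge-S

  IsEdge⇒isEdgeᵇ : ∀ {S} → IsEdge G S → isEdgeᵇ G S ≡ true
  IsEdge⇒isEdgeᵇ (∣S∣≡3 , edge-S) rewrite ∣S∣≡3 = edge-S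

  edges-through : Subset n → List (Subset n)
  edges-through S = filter (S ⊆ˢ?_) (filter (λ T → isEdgeᵇ G T ≟ᵇ true) (allSubsets n))

  edges-through-unique : ∀ S → Unique (edges-through S)
  edges-through-unique S = filter⁺ (S ⊆ˢ?_) (filter⁺ (λ T → isEdgeᵇ G T ≟ᵇ true) (allSubsets-unique n))

  ∈-edges-through⁻ : ∀ {S T} → T ∈ edges-through S → S ⊆ˢ T × IsEdge G T
  ∈-edges-through⁻ {S} T∈ with ∈-filter⁻ (S ⊆ˢ?_) {xs = filter (λ T → isEdgeᵇ G T ≟ᵇ true) (allSubsets n)} T∈
  ... | T∈edges , S⊆T = S⊆T , isEdgeᵇ⇒IsEdge (proj₂ (∈-filter⁻ (λ T → isEdgeᵇ G T ≟ᵇ true) {xs = allSubsets n} T∈edges))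

module Link {N : ℕ} (G : Graph3 (suc N)) (v : Fin (suc N)) where

  triangle : Fin N → Fin N → Subset (suc N)
  triangle a b = ⁅ v ⁆ ∪ ⁅ punchIn v a ⁆ ∪ ⁅ punchIn v b ⁆

  -- The link of v, with its vertices renumbered by punchIn v.
  link : Graph N
  link a b = not (does (a ≟ᶠ b)) ∧ isEdgeᵇ G (triangle a b)

  link-symmetric : Symmetric link
  link-symmetric a b = cong₂ _∧_ (cong not ≟-sym) (cong (isEdgeᵇ G ∘ (⁅ v ⁆ ∪_)) (∪-comm ⁅ punchIn v a ⁆ ⁅ punchIn v b ⁆))
    where
    ≟-sym : does (a ≟ᶠ b) ≡ does (b ≟ᶠ a)
    ≟-sym with a ≟ᶠ b | b ≟ᶠ a
    ... | yes _ | yes _ = refl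
    ... | no _ | no _ = refl
    ... | yes a≡b | no b≢a = ⊥-elim (b≢a (sym a≡b))
    ... | no a≢b | yes b≡a = ⊥-elim (a≢b (sym b≡a))

  link-irreflexive : Irreflexive link
  link-irreflexive a rewrite dec-true (a ≟ᶠ a) refl = refl

  link-edge : ∀ {a b} → Adj link a b → IsEdge G (triangle a b)
  link-edge {a} {b} ab with does (a ≟ᶠ b)
  ... | false = isEdgeᵇ⇒IsEdge G ab

  edge-link : ∀ {a b} → a ≢ b → IsEdge G (triangle a b) → Adj link a b
  edge-link {a} {b} a≢b edge rewrite dec-false (a ≟ᶠ b) a≢b = IsEdge⇒isEdgeᵇ G edge

  star-of-matching : ∀ {k} → Matching link k → InStarCopy k G v
  star-of-matching M =
    v , punchIn v ∘ left , punchIn v ∘ right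
    , left-injective ∘ punchIn-injective v _ _ , right-injective ∘ punchIn-injective v _ _
    , (λ x y → left≢right x y ∘ punchIn-injective v _ _)
    , (λ x → punchInᵢ≢i v (left x) ∘ sym) , (λ x → punchInᵢ≢i v (right x) ∘ sym)
    , (λ x → link-edge (adjacent x)) , inj₁ refl
    where open Family (family-of-matching M)

  triangle-at : ∀ {T a} → IsEdge G T → v ∈ˢ T → punchIn v a ∈ˢ T → ∃[ b ] Adj link a b × T ≡ triangle a b
  triangle-at {T} {a} edge-T v∈T a∈T with third-element (proj₁ edge-T) v∈T a∈T (punchInᵢ≢i v a)
  ... | y , y≢v , y≢a , T≡vay = b , edge-link a≢b (subst (IsEdge G) T≡ edge-T) , T≡
    where
    b = punchOut (y≢v ∘ sym)
    y≡b : punchIn v b ≡ y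
    y≡b = punchIn-punchOut (y≢v ∘ sym)
    a≢b : a ≢ b
    a≢b a≡b = y≢a (trans (sym y≡b) (cong (punchIn v) (sym a≡b)))
    T≡ : T ≡ triangle a b
    T≡ = trans T≡vay (cong (λ z → ⁅ v ⁆ ∪ ⁅ punchIn v a ⁆ ∪ ⁅ z ⁆) (sym y≡b))

  codegree≤degree : ∀ a → deg G (⁅ v ⁆ ∪ ⁅ punchIn v a ⁆) ≤ degree link a
  codegree≤degree a = begin
    deg G S                                                      ≤⟨ Unique⇒length≤ (edges-through-unique G S) through⊆ ⟩
    length (map (triangle a) (filter (adj? link a) (allFin N)))  ≡⟨ length-map (triangle a) (filter (adj? link a) (allFin N)) ⟩
    degree-in link a (allFin N)                                  ≡⟨ sym (degree≡degree-in link a) ⟩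
    degree link a                                                ∎
    where
    open ≤-Reasoning
    S = ⁅ v ⁆ ∪ ⁅ punchIn v a ⁆
    through⊆ : ∀ {T} → T ∈ edges-through G S → T ∈ map (triangle a) (filter (adj? link a) (allFin N))
    through⊆ T∈ with ∈-edges-through⁻ G T∈
    ... | S⊆T , edge-T with triangle-at edge-T (S⊆T (x∈p∪q⁺ (inj₁ (x∈⁅x⁆ v)))) (S⊆T (x∈p∪q⁺ (inj₂ (x∈⁅x⁆ _))))
    ... | b , ab , refl = ∈-map⁺ (triangle a) (∈-filter⁺ (adj? link a) (∈-allFin b) ab)

  private
    orient : Fin N × Fin N → Subset (suc N) × Bool
    orient (a , b) = triangle a b , does (a <ᶠ? b)

    either-orientation : ∀ {a b : Fin N} → a ≢ b → ∀ t → does (a <ᶠ? b) ≡ t ⊎ does (b <ᶠ? a) ≡ t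
    either-orientation {a} {b} a≢b t with Finₚ.<-cmp a b
    ... | tri< a<b _ _ = pick (dec-true (a <ᶠ? b) a<b) (dec-false (b <ᶠ? a) (Finₚ.<-asym a<b)) t
      where
      pick : ∀ {x y} → x ≡ true → y ≡ false → ∀ t → x ≡ t ⊎ y ≡ t
      pick x≡true _ true = inj₁ x≡true
      pick _ y≡false false = inj₂ y≡false
    ... | tri≈ _ a≡b _ = ⊥-elim (a≢b a≡b)
    ... | tri> _ _ b<a = pick (dec-false (a <ᶠ? b) (Finₚ.<-asym b<a)) (dec-true (b <ᶠ? a) b<a) t
      where
      pick : ∀ {x y} → x ≡ false → y ≡ true → ∀ t → x ≡ t ⊎ y ≡ t
      pick _ y≡true true = inj₂ y≡true
      pick x≡false _ false = inj₁ x≡false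

    arc-of-triangle : ∀ {a b} → Adj link a b → ∀ t → (triangle a b , t) ∈ map orient (arcs link)
    arc-of-triangle {a} {b} ab t with either-orientation (adj⇒≢ link link-irreflexive {a} {b} ab) t
    ... | inj₁ refl = ∈-map⁺ orient (∈-arcs⁺ link ab)
    ... | inj₂ refl = subst (λ T → (T , does (b <ᶠ? a)) ∈ map orient (arcs link))
                        (cong (⁅ v ⁆ ∪_) (∪-comm ⁅ punchIn v b ⁆ ⁅ punchIn v a ⁆))
                        (∈-map⁺ orient (∈-arcs⁺ link (trans (link-symmetric b a) ab)))

  -- Every edge {v, x, y} is the unordered form of two arcs (x, y) and (y, x) of the link.
  deg+deg≤degree-sum : deg G ⁅ v ⁆ + deg G ⁅ v ⁆ ≤ degree-sum link
  deg+deg≤degree-sum = begin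
    deg G ⁅ v ⁆ + deg G ⁅ v ⁆          ≡⟨ sym (trans (length-++ (map (_, true) through-v))
                                                     (cong₂ _+_ (length-map _ through-v) (length-map _ through-v))) ⟩
    length flagged                     ≤⟨ Unique⇒length≤ flagged-unique flagged⊆ ⟩
    length (map orient (arcs link))    ≡⟨ length-map orient (arcs link) ⟩
    length (arcs link)                 ≡⟨ length-arcs link ⟩
    degree-sum link                    ∎
    where
    open ≤-Reasoning
    through-v = edges-through G ⁅ v ⁆
    flagged : List (Subset (suc N) × Bool)
    flagged = map (_, true) through-v ++ map (_, false) through-v
    flagged-unique : Unique flagged
    flagged-unique = ++⁺ (map⁺ (cong proj₁) (edges-through-unique G ⁅ v ⁆))
                         (map⁺ (cong proj₁) (edges-through-unique G ⁅ v ⁆)) copies-disjoint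
      where
      copies-disjoint : ∀ {z} → ¬ (z ∈ map (_, true) through-v × z ∈ map (_, false) through-v)
      copies-disjoint (z∈true , z∈false) with ∈-map⁻ (_, true) z∈true | ∈-map⁻ (_, false) z∈false
      ... | _ , _ , refl | _ , _ , ()
    both-orientations : ∀ {T} → T ∈ through-v → ∀ t → (T , t) ∈ map orient (arcs link)
    both-orientations {T} T∈ t with ∈-edges-through⁻ G T∈
    ... | v⊆T , edge-T with another-element (proj₁ edge-T) (v⊆T (x∈⁅x⁆ v))
    ... | u , u∈T , u≢v with triangle-at edge-T (v⊆T (x∈⁅x⁆ v)) (subst (_∈ˢ T) (sym (punchIn-punchOut (u≢v ∘ sym))) u∈T)
    ... | b , ab , refl = arc-of-triangle ab t
    flagged⊆ : ∀ {z} → z ∈ flagged → z ∈ map orient (arcs link)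
    flagged⊆ z∈ with ∈-++⁻ (map (_, true) through-v) z∈
    ... | inj₁ z∈true with ∈-map⁻ (_, true) z∈true
    ...   | _ , T∈ , refl = both-orientations T∈ true
    flagged⊆ z∈ | inj₂ z∈false with ∈-map⁻ (_, false) z∈false
    ...   | _ , T∈ , refl = both-orientations T∈ false

module _ {N : ℕ} (G : Graph3 (suc N)) where

  covering-of-codegree : ∀ k → k + k ≤ N → k ≤ δ 2 G → HasStarCovering k G
  covering-of-codegree k 2k≤N k≤δ₂ v = star-of-matching (matching-of-minDegree link link-irreflexive k 2k≤N k≤degree)
    where
    open Link G v
    k≤degree : ∀ a → k ≤ degree link a
    k≤degree a = ≤-trans k≤δ₂ (≤-trans (δ≤deg 2 G _ (∣⁅x⁆∪⁅y⁆∣≡2 (punchInᵢ≢i v a ∘ sym))) (codegree≤degree a))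

  covering-of-degree : ∀ {K r} → N ≡ suc K + suc K + r → clique-bound K ⊔ star-bound K r < δ 1 G + δ 1 G →
    HasStarCovering (suc K) G
  covering-of-degree N≡ many v = star-of-matching (erdős-gallai N≡ link-symmetric link-irreflexive
    (<-≤-trans many (≤-trans (+-mono-≤ δ₁≤deg δ₁≤deg) deg+deg≤degree-sum)))
    where
    open Link G v
    δ₁≤deg = δ≤deg 1 G ⁅ v ⁆ (∣⁅x⁆∣≡1 v)

2k+1≤1+N⇒2k≤N : ∀ {k N} → 2 * k + 1 ≤ suc N → k + k ≤ N
2k+1≤1+N⇒2k≤N {k} {N} 2k+1≤1+N = s≤s⁻¹ (subst (_≤ suc N) (trans (+-comm (2 * k) 1) (cong (λ t → suc (k + t)) (+-identityʳ k))) 2k+1≤1+N)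

N≤[1+N]k∸kk : ∀ {k N} → 2 ≤ k → k + k ≤ N → N ≤ suc N * k ∸ k * k
N≤[1+N]k∸kk {k} {N} 2≤k 2k≤N = begin
  N                          ≡⟨ sym (m+[n∸m]≡n k≤N) ⟩
  k + s                      ≤⟨ +-monoˡ-≤ s k≤s ⟩
  s + s                      ≤⟨ m≤n+m (s + s) 2 ⟩
  2 + (s + s)                ≡⟨ solve 1 (λ s → con 2 :+ (s :+ s) := (con 1 :+ s) :* con 2) refl s ⟩
  suc s * 2                  ≤⟨ *-monoʳ-≤ (suc s) 2≤k ⟩
  suc s * k                  ≡⟨ sym (m+n∸m≡n (k * k) (suc s * k)) ⟩
  k * k + suc s * k ∸ k * k  ≡⟨ cong (_∸ k * k) (trans (sym (*-distribʳ-+ k k (suc s))) (cong (_* k) k+1+s≡1+N)) ⟩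
  suc N * k ∸ k * k          ∎
  where
  open ≤-Reasoning
  s = N ∸ k
  k≤N = m+n≤o⇒m≤o k 2k≤N
  k≤s : k ≤ s
  k≤s = subst (_≤ s) (m+n∸m≡n k k) (∸-monoˡ-≤ k 2k≤N)
  k+1+s≡1+N : k + suc s ≡ suc N
  k+1+s≡1+N = trans (+-suc k s) (cong suc (m+[n∸m]≡n k≤N))

codegree-threshold : ∀ {k N d} → 2 ≤ k → k + k ≤ N → d < k → d * N ≤ (k ∸ 2) * N + (suc N * k ∸ k * k)
codegree-threshold {suc (suc m)} {N} {d} 2≤k 2k≤N d<k = begin
  d * N                        ≤⟨ *-monoˡ-≤ N (s≤s⁻¹ d<k) ⟩
  suc m * N                    ≡⟨ +-comm N (m * N) ⟩
  m * N + N                    ≤⟨ +-monoʳ-≤ (m * N) (N≤[1+N]k∸kk 2≤k 2k≤N) ⟩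
  m * N + (suc N * suc (suc m) ∸ suc (suc m) * suc (suc m)) ∎
  where open ≤-Reasoning
codegree-threshold {suc zero} (s≤s ())

C2-double : ∀ m → suc m C 2 + suc m C 2 ≡ suc m * m
C2-double zero = refl
C2-double (suc m) = begin
  suc (suc m) C 2 + suc (suc m) C 2           ≡⟨ cong (λ x → x + x) (sym (trans (cong (_+ suc m C 2) (sym (nC1≡n (suc m)))) (nCk+nC[k+1]≡[n+1]C[k+1] (suc m) 1))) ⟩
  (suc m + suc m C 2) + (suc m + suc m C 2)   ≡⟨ solve 2 (λ a x → (a :+ x) :+ (a :+ x) := a :+ a :+ (x :+ x)) refl (suc m) (suc m C 2) ⟩
  suc m + suc m + (suc m C 2 + suc m C 2)     ≡⟨ cong (suc m + suc m +_) (C2-double m) ⟩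
  suc m + suc m + suc m * m                   ≡⟨ solve 1 (λ m → (con 1 :+ m) :+ (con 1 :+ m) :+ (con 1 :+ m) :* m := (con 2 :+ m) :* (con 1 :+ m)) refl m ⟩
  suc (suc m) * suc m                         ∎
  where open ≡-Reasoning

double-⊔ : ∀ a b → (a ⊔ b) + (a ⊔ b) ≡ (a + a) ⊔ (b + b)
double-⊔ a b = trans (cong ((a ⊔ b) +_) (sym (+-identityʳ (a ⊔ b))))
  (trans (*-distribˡ-⊔ 2 a b) (cong₂ _⊔_ (cong (a +_) (+-identityʳ a)) (cong (b +_) (+-identityʳ b))))

double-∸ : ∀ a b → (a ∸ b) + (a ∸ b) ≡ (a + a) ∸ (b + b)
double-∸ a b = trans (cong ((a ∸ b) +_) (sym (+-identityʳ (a ∸ b))))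
  (trans (*-distribˡ-∸ 2 a b) (cong₂ _∸_ (cong (a +_) (+-identityʳ a)) (cong (b +_) (+-identityʳ b))))

degree-threshold-double : ∀ K r N → N ≡ suc K + suc K + r →
  let bound = ((2 * suc K ∸ 1) C 2) ⊔ ((N C 2) ∸ ((suc N ∸ suc K) C 2)) in
  bound + bound ≡ clique-bound K ⊔ star-bound K r
degree-threshold-double K r _ refl = trans (double-⊔ ((2 * suc K ∸ 1) C 2) (N C 2 ∸ (suc N ∸ suc K) C 2)) (cong₂ _⊔_ clique star)
  where
  open ≡-Reasoning
  N = suc K + suc K + r
  clique : (2 * suc K ∸ 1) C 2 + (2 * suc K ∸ 1) C 2 ≡ clique-bound K
  clique = begin
    (2 * suc K ∸ 1) C 2 + (2 * suc K ∸ 1) C 2  ≡⟨ cong (λ t → t C 2 + t C 2) 2k-1≡ ⟩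
    suc (K + K) C 2 + suc (K + K) C 2          ≡⟨ C2-double (K + K) ⟩
    suc (K + K) * (K + K)                      ≡⟨ cong (_* (K + K)) (+-comm 1 (K + K)) ⟩
    clique-bound K                             ∎
    where
    2k-1≡ : 2 * suc K ∸ 1 ≡ suc (K + K)
    2k-1≡ = trans (cong (λ t → K + suc t) (+-identityʳ K)) (+-suc K K)
  N+1-k≡ : suc N ∸ suc K ≡ suc (suc (K + r))
  N+1-k≡ = trans (cong (_∸ K) (solve 2 (λ K r → (con 1 :+ K) :+ (con 1 :+ K) :+ r := K :+ (con 2 :+ (K :+ r))) refl K r))
                 (m+n∸m≡n K (suc (suc (K + r))))
  star : N C 2 ∸ (suc N ∸ suc K) C 2 + (N C 2 ∸ (suc N ∸ suc K) C 2) ≡ star-bound K r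
  star = begin
    N C 2 ∸ (suc N ∸ suc K) C 2 + (N C 2 ∸ (suc N ∸ suc K) C 2)
      ≡⟨ double-∸ (N C 2) ((suc N ∸ suc K) C 2) ⟩
    (N C 2 + N C 2) ∸ ((suc N ∸ suc K) C 2 + (suc N ∸ suc K) C 2)
      ≡⟨ cong₂ _∸_ (C2-double (K + suc K + r)) (trans (cong (λ t → t C 2 + t C 2) N+1-k≡) (C2-double (suc (K + r)))) ⟩
    N * (K + suc K + r) ∸ suc (suc (K + r)) * suc (K + r)
      ≡⟨ cong (_∸ suc (suc (K + r)) * suc (K + r)) (solve 2 (λ K r →
           (con 1 :+ (K :+ (con 1 :+ K) :+ r)) :* (K :+ (con 1 :+ K) :+ r)
             := (con 2 :+ (K :+ r)) :* (con 1 :+ (K :+ r)) :+ K :* (K :+ K :+ K :+ con 3 :+ (r :+ r))) refl K r) ⟩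
    suc (suc (K + r)) * suc (K + r) + star-bound K r ∸ suc (suc (K + r)) * suc (K + r)
      ≡⟨ m+n∸m≡n (suc (suc (K + r)) * suc (K + r)) (star-bound K r) ⟩
    star-bound K r ∎

-- Only the second term of the maximum is needed.
codegree-condition : ∀ {k N} (G : Graph3 (suc N)) → 3 ≤ k → 2 * k + 1 ≤ suc N → ¬ HasStarCovering k G →
  δ 2 G * N ≤ (4 * k * k ∸ 6 * k + 2) ⊔ ((k ∸ 2) * N + (suc N * k ∸ k * k))
codegree-condition {k} {N} G 3≤k 2k+1≤1+N no-cover with δ 2 G * N ≤? (4 * k * k ∸ 6 * k + 2) ⊔ ((k ∸ 2) * N + (suc N * k ∸ k * k))
... | yes small = small
... | no large = ⊥-elim (no-cover (covering-of-codegree G k 2k≤N k≤δ₂))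
  where
  2k≤N = 2k+1≤1+N⇒2k≤N {k} 2k+1≤1+N
  k≤δ₂ : k ≤ δ 2 G
  k≤δ₂ = ≮⇒≥ λ δ₂<k → large (≤-trans (codegree-threshold (≤-trans (s≤s (s≤s z≤n)) 3≤k) 2k≤N δ₂<k) (m≤n⊔m (4 * k * k ∸ 6 * k + 2) _))

degree-condition : ∀ {K N} (G : Graph3 (suc N)) → 2 * suc K + 1 ≤ suc N → ¬ HasStarCovering (suc K) G →
  δ 1 G ≤ ((2 * suc K ∸ 1) C 2) ⊔ ((N C 2) ∸ ((suc N ∸ suc K) C 2))
degree-condition {K} {N} G 2k+1≤1+N no-cover with δ 1 G ≤? ((2 * suc K ∸ 1) C 2) ⊔ ((N C 2) ∸ ((suc N ∸ suc K) C 2))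
... | yes small = small
... | no large = ⊥-elim (no-cover (covering-of-degree G N≡ (subst (_< δ 1 G + δ 1 G)
                   (degree-threshold-double K r N N≡) (+-mono-< (≰⇒> large) (≰⇒> large)))))
  where
  r = N ∸ (suc K + suc K)
  N≡ : N ≡ suc K + suc K + r
  N≡ = sym (m+[n∸m]≡n (2k+1≤1+N⇒2k≤N {suc K} 2k+1≤1+N))

proposition1 : (k n : ℕ) → 3 ≤ k → 2 * k + 1 ≤ n →
    ((G : Graph3 n) → ¬ HasStarCovering k G →
      δ 2 G * (n ∸ 1) ≤ (4 * k * k ∸ 6 * k + 2) ⊔ ((k ∸ 2) * (n ∸ 1) + (n * k ∸ k * k)))
    ×
    ((G : Graph3 n) → ¬ HasStarCovering k G →
      δ 1 G ≤ ((2 * k ∸ 1) C 2) ⊔ (((n ∸ 1) C 2) ∸ ((n ∸ k) C 2)))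
proposition1 (suc K) (suc N) 3≤k 2k+1≤n =
  (λ G → codegree-condition G 3≤k 2k+1≤n) , (λ G → degree-condition G 2k+1≤n)
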